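{- Let $\mathcal{M}$ be a simple oriented matroid (no loops, no parallel or antiparallel elements) on the ground set $E_t=\{1,\ldots,t\}$ which is not acyclic, and let $\mathcal{T}$ be its set of topes. Let $k$ be an integer with $3\leq k\leq|\mathcal{T}|-3$. Suppose that for every family $\mathcal{G}\subseteq\bigcup_{e\in E_t}\binom{\mathcal{T}^+_e}{\lceil(k+1)/2\rceil}$ such that $\bigcup_{F\in\min\gamma_k(\mathcal{G})}F=E_t$ and $|\bigcup_{G\in\mathcal{G}}G|\leq k$, one has $|\gamma_k(G)|=1$ for every $G\in\mathcal{G}$. Then \[ \#\mathbf{K}^{\ast}_k(\mathcal{M})=\#\mathbf{K}^{\ast}_{|\mathcal{T}|-k}(\mathcal{M})=(-1)^t\cdot \sum_{\mathcal{G}}(-1)^{\#\mathcal{G}}\cdot \binom{|\mathcal{T}|-|\bigcup_{G\in\mathcal{G}}G|}{k-|\bigcup_{G\in\mathcal{G}}G|}\ , \] where the sum runs over all families $\mathcal{G}\subseteq\bigcup_{e\in E_t}\binom{\mathcal{T}^+_e}{\lceil(k+1)/2\rceil}$ with $t\leq\#\mathcal{G}\leq\binom{k}{\lceil(k+1)/2\rceil}$, $\bigcup_{F\in\min\gamma_k(\mathcal{G})}F=E_t$ and $|\bigcup_{G\in\mathcal{G}}G|\leq k$.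
   Context: Topes are the maximal covectors of $\mathcal{M}$, viewed as sign vectors $T\in\{+,-\}^{E_t}$; $\mathcal{T}=-\mathcal{T}$. For $e\in E_t$, $\mathcal{T}^+_e:=\{T\in\mathcal{T}: T(e)=+\}$, and for $A\subseteq E_t$, $\mathcal{T}^+_A:=\bigcap_{a\in A}\mathcal{T}^+_a$. $\binom{S}{j}$ is the family of $j$-subsets of a set $S$. $\mathbf{K}^{\ast}_k(\mathcal{M}):=\{\mathcal{K}^{\ast}\subset\mathcal{T}: |\mathcal{K}^{\ast}|=k,\ |\mathcal{K}^{\ast}\cap\mathcal{T}^+_e|>k/2\ \ \forall e\in E_t\}$ (tope committees of cardinality $k$). A subset $A\subseteq E_t$ is convex if there is no signed circuit $X$ of $\mathcal{M}$ with $X^+\subseteq A$ and $X^-=\{e\}$ for some $e\notin A$. For a set $d$ of $\lceil(k+1)/2\rceil$ topes contained in some positive halfspace, $\gamma_k(d)$ is the inclusion-maximum convex subset $A\subseteq E_t$ with $d\subseteq\mathcal{T}^+_A$ (equivalently, $\gamma_k(d)=\{e\in E_t: T(e)=+\ \forall T\in d\}$). For a family $\mathcal{G}$ of such sets, $\gamma_k(\mathcal{G}):=\{\gamma_k(G):G\in\mathcal{G}\}$ and $\min\gamma_k(\mathcal{G})$ is the subfamily of its inclusion-minimal members. -}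

module Defs where

open import Data.Bool using (Bool; true; false; _∧_; _∨_; not; T)
open import Data.Nat using (ℕ; zero; suc; _+_; _*_; _∸_; _<ᵇ_; _≤ᵇ_; _≡ᵇ_; ⌈_/2⌉)
open import Data.Nat.Combinatorics using (_C_)
open import Data.Fin using (Fin)
open import Data.Fin.Subset using (Subset; ∣_∣)
open import Data.Vec using (Vec; []; _∷_; lookup; tabulate)
import Data.Vec as Vec
open import Data.List using (List; []; _∷_; _++_; length; foldr)
import Data.List as List
open import Data.Integer using (ℤ; +_; -_; _^_) renaming (_*_ to _*ℤ_; _+_ to _+ℤ_)
open import Data.Product using (Σ; _×_)
open import Data.Sum using (_⊎_)
open import Relation.Nullary using (¬_)
open import Relation.Binary.PropositionalEquality using (_≡_; _≢_)

allFin : ∀ {n} → (Fin n → Bool) → Bool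
allFin {n} p = Vec.foldr (λ _ → Bool) _∧_ true (tabulate p)

anyFin : ∀ {n} → (Fin n → Bool) → Bool
anyFin {n} p = Vec.foldr (λ _ → Bool) _∨_ false (tabulate p)

filterᵇ : ∀ {A : Set} → (A → Bool) → List A → List A
filterᵇ p []       = []
filterᵇ p (x ∷ xs) with p x
... | true  = x ∷ filterᵇ p xs
... | false = filterᵇ p xs

allList anyList : ∀ {A : Set} → (A → Bool) → List A → Bool
allList p = foldr (λ x b → p x ∧ b) true
anyList p = foldr (λ x b → p x ∨ b) false

allSubsets : (n : ℕ) → List (Subset n)
allSubsets zero    = [] ∷ []
allSubsets (suc n) = List.map (false ∷_) (allSubsets n) ++ List.map (true ∷_) (allSubsets n)

_⊆ᵇ_ : ∀ {n} → Subset n → Subset n → Bool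
A ⊆ᵇ B = allFin (λ e → not (lookup A e) ∨ lookup B e)

_⊂ᵇ_ : ∀ {n} → Subset n → Subset n → Bool
A ⊂ᵇ B = (A ⊆ᵇ B) ∧ not (B ⊆ᵇ A)

data Sign : Set where
  ⊕ ⊖ 𝟘 : Sign

negˢ : Sign → Sign
negˢ ⊕ = ⊖
negˢ ⊖ = ⊕
negˢ 𝟘 = 𝟘

_*ˢ_ : Sign → Sign → Sign
𝟘 *ˢ _ = 𝟘
_ *ˢ 𝟘 = 𝟘
⊕ *ˢ ⊕ = ⊕
⊖ *ˢ ⊖ = ⊕
⊕ *ˢ ⊖ = ⊖
⊖ *ˢ ⊕ = ⊖

_==ˢ_ : Sign → Sign → Bool
⊕ ==ˢ ⊕ = true
⊖ ==ˢ ⊖ = true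
𝟘 ==ˢ 𝟘 = true
_ ==ˢ _ = false

isPos isNeg isNonzero : Sign → Bool
isPos s = s ==ˢ ⊕
isNeg s = s ==ˢ ⊖
isNonzero s = not (s ==ˢ 𝟘)

SignVec : ℕ → Set
SignVec t = Vec Sign t

negᵛ : ∀ {t} → SignVec t → SignVec t
negᵛ = Vec.map negˢ

zeroᵛ : ∀ {t} → SignVec t
zeroᵛ = Vec.replicate _ 𝟘

_⁺ _⁻ supp : ∀ {t} → SignVec t → Subset t
X ⁺ = Vec.map isPos X
X ⁻ = Vec.map isNeg X
supp X = Vec.map isNonzero X

allSignVecs : (t : ℕ) → List (SignVec t)
allSignVecs zero    = [] ∷ []
allSignVecs (suc t) =
  List.map (⊕ ∷_) (allSignVecs t) ++ (List.map (⊖ ∷_) (allSignVecs t) ++ List.map (𝟘 ∷_) (allSignVecs t))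

-- Oriented matroids via the circuit axioms (Björner et al., Def. 3.2.1)

record OrientedMatroid (t : ℕ) : Set where
  field
    isCircuit : SignVec t → Bool
    C0 : isCircuit zeroᵛ ≡ false
    C1 : ∀ X → T (isCircuit X) → T (isCircuit (negᵛ X))
    C2 : ∀ X Y → T (isCircuit X) → T (isCircuit Y) → T (supp X ⊆ᵇ supp Y) →
         (X ≡ Y) ⊎ (X ≡ negᵛ Y)
    C3 : ∀ X Y (e : Fin t) → T (isCircuit X) → T (isCircuit Y) → X ≢ negᵛ Y →
         lookup X e ≡ ⊕ → lookup Y e ≡ ⊖ →
         Σ (SignVec t) λ Z → T (isCircuit Z) × lookup Z e ≡ 𝟘 ×
           (∀ f → lookup Z f ≡ ⊕ → (lookup X f ≡ ⊕ ⊎ lookup Y f ≡ ⊕)) ×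
           (∀ f → lookup Z f ≡ ⊖ → (lookup X f ≡ ⊖ ⊎ lookup Y f ≡ ⊖))

module _ {t : ℕ} (M : OrientedMatroid t) where
  open OrientedMatroid M

  -- simple: no loops and no parallel/antiparallel elements,
  -- i.e. no circuit has support of size 1 or 2.
  Simple : Set
  Simple = ∀ X → T (isCircuit X) → 2 Data.Nat.< ∣ supp X ∣

  Acyclic : Set
  Acyclic = ¬ (Σ (SignVec t) λ X → T (isCircuit X) × (∀ e → lookup X e ≢ ⊖))

  NotAcyclic : Set
  NotAcyclic = ¬ Acyclic

  orthᵇ : SignVec t → SignVec t → Bool
  orthᵇ X Y = not (anyFin (λ e → isNonzero (lookup X e *ˢ lookup Y e)))
            ∨ (anyFin (λ e → isPos (lookup X e *ˢ lookup Y e))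
               ∧ anyFin (λ e → isNeg (lookup X e *ˢ lookup Y e)))

  isCovector : SignVec t → Bool
  isCovector X = allList (λ Y → not (isCircuit Y) ∨ orthᵇ X Y) (allSignVecs t)

  _≤ᶜ_ : SignVec t → SignVec t → Bool
  X ≤ᶜ Y = allFin (λ e → (lookup X e ==ˢ 𝟘) ∨ (lookup X e ==ˢ lookup Y e))

  isTope : SignVec t → Bool
  isTope X = isCovector X ∧
    not (anyList (λ Y → isCovector Y ∧ (X ≤ᶜ Y) ∧ not (Y ≤ᶜ X)) (allSignVecs t))

  topes : List (SignVec t)
  topes = filterᵇ isTope (allSignVecs t)

  nT : ℕ
  nT = length topes

  tope : Fin nT → SignVec t
  tope = List.lookup topes

  TopeSet : Set
  TopeSet = Subset nT

  countPos : TopeSet → Fin t → ℕ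
  countPos S e = ∣ tabulate (λ i → lookup S i ∧ isPos (lookup (tope i) e)) ∣

  isCommittee : ℕ → TopeSet → Bool
  isCommittee k S = (∣ S ∣ ≡ᵇ k) ∧ allFin (λ e → k <ᵇ 2 * countPos S e)

  numCommittees : ℕ → ℕ
  numCommittees k = length (filterᵇ (isCommittee k) (allSubsets nT))

  module _ (k : ℕ) where
    m : ℕ
    m = ⌈ suc k /2⌉

    inPosHalf : TopeSet → Fin t → Bool
    inPosHalf S e = allFin (λ i → not (lookup S i) ∨ isPos (lookup (tope i) e))

    candidates : List TopeSet
    candidates = filterᵇ (λ S → (∣ S ∣ ≡ᵇ m) ∧ anyFin (inPosHalf S)) (allSubsets nT)

    N : ℕ
    N = length candidates

    cand : Fin N → TopeSet
    cand = List.lookup candidates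

    Family : Set
    Family = Subset N

    γ : TopeSet → Subset t
    γ S = tabulate (inPosHalf S)

    ⋃𝒢 : Family → TopeSet
    ⋃𝒢 𝒢 = tabulate (λ i → anyFin (λ j → lookup 𝒢 j ∧ lookup (cand j) i))

    isMinγ : Family → Fin N → Bool
    isMinγ 𝒢 j = not (anyFin (λ j′ → lookup 𝒢 j′ ∧ (γ (cand j′) ⊂ᵇ γ (cand j))))

    coversᵇ : Family → Bool
    coversᵇ 𝒢 = allFin (λ e → anyFin (λ j → lookup 𝒢 j ∧ isMinγ 𝒢 j ∧ lookup (γ (cand j)) e))

    admissible : Family → Bool
    admissible 𝒢 = coversᵇ 𝒢 ∧ (∣ ⋃𝒢 𝒢 ∣ ≤ᵇ k)

    inRange : Family → Bool
    inRange 𝒢 = admissible 𝒢 ∧ (t ≤ᵇ ∣ 𝒢 ∣) ∧ (∣ 𝒢 ∣ ≤ᵇ (k C m))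

    term : Family → ℤ
    term 𝒢 = ((- (+ 1)) ^ ∣ 𝒢 ∣) *ℤ (+ ((nT ∸ ∣ ⋃𝒢 𝒢 ∣) C (k ∸ ∣ ⋃𝒢 𝒢 ∣)))

    sumℤ : List ℤ → ℤ
    sumℤ = foldr _+ℤ_ (+ 0)

    rhs : ℤ
    rhs = ((- (+ 1)) ^ t) *ℤ sumℤ (List.map term (filterᵇ inRange (allSubsets N)))

-- For the symmetry: topes of a simple oriented matroid have full support, since a covector
-- with a zero entry extends coordinate by coordinate to a strictly larger covector (if neither sign works
-- at e, eliminating e between the two obstructing circuits gives a circuit conformal to the current
-- vector, which orthogonality forbids). As -T is a tope whenever T is, S ↦ 𝒯 ∖ (-S) then maps the
-- committees of size k bijectively onto those of size |𝒯| - k.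
-- For the formula: a k-set S of topes is a committee iff every e ∈ E_t lies in γ(d) for a candidate
-- d ⊆ S. Reading each binomial coefficient as the number of k-supersets S of ⋃𝒢 and exchanging the
-- sums, S receives the signed count of the covering families of candidates inside S. The hypothesis,
-- applied to the candidates in S with maximal γ, makes every such γ(d) a single element, so this signed
-- count factorises over E_t and equals (-1)^t for a committee S and 0 otherwise.

module Submission where

open import Defs
open import Data.Bool using (Bool; true; false; _∧_; _∨_; not; T)
import Data.Bool as Bool
open import Data.Bool.Properties using (T-∧; T-∨; T-≡; T-not-≡; ∧-zeroʳ; ∨-identityʳ; ∨-zeroʳ; ∨-assoc; not-involutive; ∧-comm)
open import Data.Empty using (⊥; ⊥-elim)
open import Data.Fin using (Fin; zero; suc)
import Data.Fin as Fin
import Data.Fin.Properties as FinP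
open import Data.Fin.Subset using (Subset; ∣_∣; ⊤; ⁅_⁆) renaming (_∈_ to _∈ˢ_)
open import Data.Fin.Subset.Properties using (∣p∣≤n; ∣⊤∣≡n; ∣⁅x⁆∣≡1; x∈⁅x⁆; p⊆q⇒∣p∣≤∣q∣; p⊂q⇒∣p∣<∣q∣; x∈p⇒∣p-x∣<∣p∣)
open import Data.List using (List; []; _∷_; _++_; length; map; filter)
import Data.List as List
import Data.List.Properties as List
open import Data.List.Membership.Propositional using (_∈_)
open import Data.List.Membership.Propositional.Properties using (∈-map⁺; ∈-map⁻; ∈-++⁺ˡ; ∈-++⁺ʳ; ∈-filter⁺; ∈-filter⁻; ∈-lookup; ∈-++⁻; ∈-allFin)
open import Data.List.Relation.Unary.Unique.Propositional using (Unique; []; _∷_)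
import Data.List.Relation.Unary.Unique.Propositional.Properties as Unique
open import Data.List.Relation.Unary.All as All using (All; []; _∷_)
open import Data.List.Relation.Unary.Any as Any using (Any; here; there)
open import Data.List.Relation.Unary.Any.Properties using (lookup-index)
open import Data.Nat using (ℕ; zero; suc; _∸_; _≤_; _<_; z≤n; s≤s; _≡ᵇ_; _<ᵇ_; ⌈_/2⌉; ⌊_/2⌋)
open import Data.Nat using () renaming (_+_ to _+ⁿ_; _*_ to _*ⁿ_)
open import Data.Nat.Combinatorics using (_C_; nCk+nC[k+1]≡[n+1]C[k+1])
import Data.Nat.Properties as ℕ
open import Data.Product using (Σ; ∃; _×_; _,_; proj₁; proj₂)
open import Data.Sum using (_⊎_; inj₁; inj₂; [_,_]′; map₂)
open import Data.Unit using (tt)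
open import Data.Integer using (ℤ; +_; -_; _+_; _-_; _*_; _^_)
import Data.Integer.Properties as ℤ
open import Data.Integer.Tactic.RingSolver using (solve-∀)
import Data.Nat.Tactic.RingSolver as ℕSolver
open import Data.Vec using (Vec; []; _∷_; lookup; tabulate; _[_]≔_)
import Data.Vec.Properties as Vec
open import Data.Vec.Properties using (lookup∘tabulate; lookup⇒[]=; []=⇒lookup)
open import Function using (_∘_; id; case_of_)
open import Function.Bundles using (_⇔_; mk⇔; Equivalence)
open import Relation.Nullary using (¬_; does; yes; no)
open import Relation.Nullary.Decidable using (T?)
open import Relation.Binary.Definitions using (DecidableEquality)
open import Relation.Binary.PropositionalEquality

open Equivalence using (to; from)

private variable A B : Set

T-not : ∀ {b} → T (not b) ⇔ (¬ T b)
T-not {true}  = mk⇔ (λ ()) (λ h → h tt)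
T-not {false} = mk⇔ (λ _ ()) (λ _ → tt)

T-⇒ : ∀ {a b} → T (not a ∨ b) ⇔ (T a → T b)
T-⇒ {true}  = mk⇔ (λ h _ → h) (λ h → h tt)
T-⇒ {false} = mk⇔ (λ _ ()) (λ _ → tt)

¬T-⇒ : ∀ {a b} → ¬ T (not a ∨ b) → T a × ¬ T b
¬T-⇒ {true}  h = tt , h
¬T-⇒ {false} h = ⊥-elim (h tt)

T-dec : ∀ b → T b ⊎ ¬ T b
T-dec true  = inj₁ tt
T-dec false = inj₂ λ ()

T-ext : ∀ {a b} → (T a → T b) → (T b → T a) → a ≡ b
T-ext {true}  {true}  _ _ = refl
T-ext {true}  {false} f _ = ⊥-elim (f tt)
T-ext {false} {true}  _ g = ⊥-elim (g tt)
T-ext {false} {false} _ _ = refl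

allFin⁺ : ∀ {n} {p : Fin n → Bool} → (∀ i → T (p i)) → T (allFin p)
allFin⁺ {zero}  h = tt
allFin⁺ {suc n} h = from T-∧ (h zero , allFin⁺ (h ∘ suc))

allFin⁻ : ∀ {n} {p : Fin n → Bool} → T (allFin p) → ∀ i → T (p i)
allFin⁻ h zero = proj₁ (to T-∧ h)
allFin⁻ {p = p} h (suc i) = allFin⁻ (proj₂ (to (T-∧ {p zero}) h)) i

¬allFin⁻ : ∀ {n} {p : Fin n → Bool} → ¬ T (allFin p) → ∃ λ i → ¬ T (p i)
¬allFin⁻ {zero}      h = ⊥-elim (h tt)
¬allFin⁻ {suc n} {p} h with T-dec (p zero)
... | inj₂ ¬q = zero , ¬q
... | inj₁ q with ¬allFin⁻ (λ h′ → h (from T-∧ (q , h′)))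
...   | i , ¬q = suc i , ¬q

anyFin⁺ : ∀ {n} {p : Fin n → Bool} i → T (p i) → T (anyFin p)
anyFin⁺ zero    q = from T-∨ (inj₁ q)
anyFin⁺ {p = p} (suc i) q = from (T-∨ {p zero}) (inj₂ (anyFin⁺ i q))

anyFin⁻ : ∀ {n} {p : Fin n → Bool} → T (anyFin p) → ∃ (T ∘ p)
anyFin⁻ {suc n} {p} h with to (T-∨ {p zero}) h
... | inj₁ q = zero , q
... | inj₂ h′ with anyFin⁻ h′
...   | i , q = suc i , q

allFin-cong : ∀ {n} {p q : Fin n → Bool} → (∀ i → p i ≡ q i) → allFin p ≡ allFin q
allFin-cong {zero}  e = refl
allFin-cong {suc n} e = cong₂ _∧_ (e zero) (allFin-cong (e ∘ suc))

anyFin-cong : ∀ {n} {p q : Fin n → Bool} → (∀ i → p i ≡ q i) → anyFin p ≡ anyFin q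
anyFin-cong {zero}  e = refl
anyFin-cong {suc n} e = cong₂ _∨_ (e zero) (anyFin-cong (e ∘ suc))

allList⁺ : ∀ {p : A → Bool} {xs} → (∀ {x} → x ∈ xs → T (p x)) → T (allList p xs)
allList⁺ {xs = []}     h = tt
allList⁺ {xs = x ∷ xs} h = from T-∧ (h (here refl) , allList⁺ (h ∘ there))

allList⁻ : ∀ {p : A → Bool} {xs x} → T (allList p xs) → x ∈ xs → T (p x)
allList⁻ {p = p} {y ∷ _} h (here refl) = proj₁ (to (T-∧ {p y}) h)
allList⁻ {p = p} {y ∷ _} h (there x∈) = allList⁻ (proj₂ (to (T-∧ {p y}) h)) x∈

¬allList⁻ : ∀ {p : A → Bool} {xs} → ¬ T (allList p xs) → ∃ λ x → ¬ T (p x)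
¬allList⁻ {xs = []}         h = ⊥-elim (h tt)
¬allList⁻ {p = p} {x ∷ xs} h with T-dec (p x)
... | inj₂ ¬q = x , ¬q
... | inj₁ q  = ¬allList⁻ {p = p} {xs} (λ h′ → h (from T-∧ (q , h′)))

anyList⁺ : ∀ {p : A → Bool} {xs x} → x ∈ xs → T (p x) → T (anyList p xs)
anyList⁺ {p = p} {y ∷ _} (here refl) q = from (T-∨ {p y}) (inj₁ q)
anyList⁺ {p = p} {y ∷ _} (there x∈) q = from (T-∨ {p y}) (inj₂ (anyList⁺ x∈ q))

anyList⁻ : ∀ {p : A → Bool} {xs} → T (anyList p xs) → ∃ (T ∘ p)
anyList⁻ {p = p} {x ∷ xs} h with to (T-∨ {p x}) h
... | inj₁ q  = x , q
... | inj₂ h′ = anyList⁻ {p = p} {xs} h′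

allList-cong : ∀ {p q : A → Bool} xs → (∀ x → p x ≡ q x) → allList p xs ≡ allList q xs
allList-cong []       e = refl
allList-cong (x ∷ xs) e = cong₂ _∧_ (e x) (allList-cong xs e)

filterᵇ-filter : ∀ (p : A → Bool) xs → filterᵇ p xs ≡ filter (T? ∘ p) xs
filterᵇ-filter p []       = refl
filterᵇ-filter p (x ∷ xs) with p x
... | true  = cong (x ∷_) (filterᵇ-filter p xs)
... | false = filterᵇ-filter p xs

lookup-injective : ∀ {xs : List A} → Unique xs →
  ∀ {i j} → List.lookup xs i ≡ List.lookup xs j → i ≡ j
lookup-injective (_  ∷ _) {zero}  {zero}  _ = refl
lookup-injective (x∉ ∷ _) {zero}  {suc j} e = ⊥-elim (All.lookup x∉ (∈-lookup j) e)
lookup-injective (x∉ ∷ _) {suc i} {zero}  e = ⊥-elim (All.lookup x∉ (∈-lookup i) (sym e))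
lookup-injective (_  ∷ u) {suc i} {suc j} e = cong suc (lookup-injective u e)

prefixed-disjoint : ∀ {n} {a b : A} → a ≢ b → (xs ys : List (Vec A n)) →
  ∀ {v} → ¬ (v ∈ map (a ∷_) xs × v ∈ map (b ∷_) ys)
prefixed-disjoint {a = a} {b} a≢b xs ys (v∈xs , v∈ys) with ∈-map⁻ (a ∷_) v∈xs | ∈-map⁻ (b ∷_) v∈ys
... | _ , _ , refl | _ , _ , refl = a≢b refl

∈-allSubsets : ∀ {n} (S : Subset n) → S ∈ allSubsets n
∈-allSubsets []          = here refl
∈-allSubsets (false ∷ S) = ∈-++⁺ˡ (∈-map⁺ (false ∷_) (∈-allSubsets S))
∈-allSubsets {suc n} (true ∷ S) = ∈-++⁺ʳ (map (false ∷_) (allSubsets n)) (∈-map⁺ (true ∷_) (∈-allSubsets S))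

allSubsets-unique : ∀ n → Unique (allSubsets n)
allSubsets-unique zero    = [] ∷ []
allSubsets-unique (suc n) = Unique.++⁺ (Unique.map⁺ Vec.∷-injectiveʳ (allSubsets-unique n))
  (Unique.map⁺ Vec.∷-injectiveʳ (allSubsets-unique n)) (prefixed-disjoint (λ ()) (allSubsets n) (allSubsets n))

∈-allSignVecs : ∀ {t} (X : SignVec t) → X ∈ allSignVecs t
∈-allSignVecs []      = here refl
∈-allSignVecs (⊕ ∷ X) = ∈-++⁺ˡ (∈-map⁺ (⊕ ∷_) (∈-allSignVecs X))
∈-allSignVecs {suc t} (⊖ ∷ X) = ∈-++⁺ʳ (map (⊕ ∷_) (allSignVecs t)) (∈-++⁺ˡ (∈-map⁺ (⊖ ∷_) (∈-allSignVecs X)))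
∈-allSignVecs {suc t} (𝟘 ∷ X) =
  ∈-++⁺ʳ (map (⊕ ∷_) (allSignVecs t)) (∈-++⁺ʳ (map (⊖ ∷_) (allSignVecs t)) (∈-map⁺ (𝟘 ∷_) (∈-allSignVecs X)))

allSignVecs-unique : ∀ t → Unique (allSignVecs t)
allSignVecs-unique zero    = [] ∷ []
allSignVecs-unique (suc t) = Unique.++⁺ (prefixed ⊕)
  (Unique.++⁺ (prefixed ⊖) (prefixed 𝟘) (prefixed-disjoint (λ ()) vs vs))
  λ { (v∈⊕ , v∈⊖𝟘) → [ (λ v∈⊖ → prefixed-disjoint (λ ()) vs vs (v∈⊕ , v∈⊖))
                     , (λ v∈𝟘 → prefixed-disjoint (λ ()) vs vs (v∈⊕ , v∈𝟘)) ]′ (∈-++⁻ (map (⊖ ∷_) vs) v∈⊖𝟘) }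
  where
  vs = allSignVecs t
  prefixed : ∀ s → Unique (map (s ∷_) vs)
  prefixed s = Unique.map⁺ Vec.∷-injectiveʳ (allSignVecs-unique t)

module _ (p : A → Bool) {xs : List A} where

  ∈-filterᵇ⁺ : ∀ {x} → x ∈ xs → T (p x) → x ∈ filterᵇ p xs
  ∈-filterᵇ⁺ x∈ px = subst (_ ∈_) (sym (filterᵇ-filter p xs)) (∈-filter⁺ (T? ∘ p) x∈ px)

  ∈-filterᵇ⁻ : ∀ {x} → x ∈ filterᵇ p xs → x ∈ xs × T (p x)
  ∈-filterᵇ⁻ x∈ = ∈-filter⁻ (T? ∘ p) (subst (_ ∈_) (filterᵇ-filter p xs) x∈)

  filterᵇ-unique : Unique xs → Unique (filterᵇ p xs)
  filterᵇ-unique u = subst Unique (sym (filterᵇ-filter p xs)) (Unique.filter⁺ (T? ∘ p) u)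

_⊆ᵀ_ : ∀ {n} → Subset n → Subset n → Set
A ⊆ᵀ B = ∀ i → T (lookup A i) → T (lookup B i)

⊆ᵇ⁺ : ∀ {n} (A B : Subset n) → A ⊆ᵀ B → T (A ⊆ᵇ B)
⊆ᵇ⁺ A B h = allFin⁺ λ i → from (T-⇒ {lookup A i}) (h i)

⊆ᵇ⁻ : ∀ {n} (A B : Subset n) → T (A ⊆ᵇ B) → A ⊆ᵀ B
⊆ᵇ⁻ A B h i = to (T-⇒ {lookup A i}) (allFin⁻ h i)

¬⊆ᵇ⁻ : ∀ {n} (A B : Subset n) → ¬ T (A ⊆ᵇ B) → ∃ λ i → T (lookup A i) × ¬ T (lookup B i)
¬⊆ᵇ⁻ A B h with ¬allFin⁻ h
... | i , ¬imp = i , ¬T-⇒ ¬imp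

T-lookup : ∀ {n} {p : Subset n} {i} → T (lookup p i) ⇔ i ∈ˢ p
T-lookup {p = p} {i} = mk⇔ (λ h → lookup⇒[]= i p (to T-≡ h)) (λ h → from T-≡ ([]=⇒lookup h))

⊆ᵀ⇒⊆ : ∀ {n} (A B : Subset n) → A ⊆ᵀ B → ∀ {i} → i ∈ˢ A → i ∈ˢ B
⊆ᵀ⇒⊆ A B h {i} i∈A = to (T-lookup {p = B}) (h i (from (T-lookup {p = A}) i∈A))

∣∣-mono : ∀ {n} (A B : Subset n) → A ⊆ᵀ B → ∣ A ∣ ≤ ∣ B ∣
∣∣-mono A B h = p⊆q⇒∣p∣≤∣q∣ (⊆ᵀ⇒⊆ A B h)

∣∣-strict : ∀ {n} (A B : Subset n) → A ⊆ᵀ B → ∀ i → T (lookup B i) → ¬ T (lookup A i) → ∣ A ∣ < ∣ B ∣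
∣∣-strict A B h i b ¬a = p⊂q⇒∣p∣<∣q∣ (⊆ᵀ⇒⊆ A B h , i , to (T-lookup {p = B}) b , ¬a ∘ from (T-lookup {p = A}))

∣∣-pos : ∀ {n} (A : Subset n) i → T (lookup A i) → 0 < ∣ A ∣
∣∣-pos A i a = ℕ.<-≤-trans (s≤s z≤n) (x∈p⇒∣p-x∣<∣p∣ (to (T-lookup {p = A}) a))

∣∣≡1⇒unique : ∀ {n} (A : Subset n) → ∣ A ∣ ≡ 1 → ∀ {i j} → T (lookup A i) → T (lookup A j) → i ≡ j
∣∣≡1⇒unique (true ∷ A)  e {zero}  {zero}  _ _ = refl
∣∣≡1⇒unique (true ∷ A)  e {zero}  {suc j} _ b = ⊥-elim (ℕ.<⇒≢ (∣∣-pos A j b) (sym (ℕ.suc-injective e)))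
∣∣≡1⇒unique (true ∷ A)  e {suc i} {_}     a _ = ⊥-elim (ℕ.<⇒≢ (∣∣-pos A i a) (sym (ℕ.suc-injective e)))
∣∣≡1⇒unique (false ∷ A) e {suc i} {suc j} a b = cong suc (∣∣≡1⇒unique A e a b)

subset-of-size : ∀ {n} m (V : Subset n) → m ≤ ∣ V ∣ → Σ (Subset n) λ G → G ⊆ᵀ V × ∣ G ∣ ≡ m
subset-of-size {zero}  zero    []      _ = [] , (λ ()) , refl
subset-of-size {suc n} zero    (_ ∷ V) _ with subset-of-size zero V z≤n
... | G , G⊆V , ∣G∣≡0 = false ∷ G , (λ { (suc i) g → G⊆V i g }) , ∣G∣≡0
subset-of-size {suc n} (suc m) (true ∷ V)  (s≤s m≤∣V∣) with subset-of-size m V m≤∣V∣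
... | G , G⊆V , ∣G∣≡m = true ∷ G , (λ { zero _ → tt ; (suc i) g → G⊆V i g }) , cong suc ∣G∣≡m
subset-of-size {suc n} (suc m) (false ∷ V) m<∣V∣      with subset-of-size (suc m) V m<∣V∣
... | G , G⊆V , ∣G∣≡m = false ∷ G , (λ { (suc i) g → G⊆V i g }) , ∣G∣≡m

∑ : List A → (A → ℤ) → ℤ
∑ []       f = + 0
∑ (x ∷ xs) f = f x + ∑ xs f

infix 5 ∑
syntax ∑ xs (λ x → e) = ∑[ x ∈ xs ] e

ind : Bool → ℤ
ind true  = + 1
ind false = + 0

ind-false : ∀ {b} → ¬ T b → ind b ≡ + 0
ind-false {true}  ¬b = ⊥-elim (¬b tt)
ind-false {false} _  = refl

∑-++ : ∀ (xs ys : List A) f → ∑ (xs ++ ys) f ≡ ∑ xs f + ∑ ys f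
∑-++ []       ys f = sym (ℤ.+-identityˡ _)
∑-++ (x ∷ xs) ys f = trans (cong (_+_ (f x)) (∑-++ xs ys f)) (sym (ℤ.+-assoc (f x) _ _))

∑-cong : ∀ (xs : List A) {f g} → (∀ x → f x ≡ g x) → ∑ xs f ≡ ∑ xs g
∑-cong []       e = refl
∑-cong (x ∷ xs) e = cong₂ _+_ (e x) (∑-cong xs e)

∑-zero : ∀ (xs : List A) {f} → (∀ {x} → x ∈ xs → f x ≡ + 0) → ∑ xs f ≡ + 0
∑-zero []       e = refl
∑-zero (x ∷ xs) e = cong₂ _+_ (e (here refl)) (∑-zero xs (e ∘ there))

∑-+ : ∀ (xs : List A) f g → ∑[ x ∈ xs ] (f x + g x) ≡ ∑ xs f + ∑ xs g
∑-+ []       f g = refl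
∑-+ (x ∷ xs) f g = trans (cong (_+_ (f x + g x)) (∑-+ xs f g)) (interchange (f x) (g x) _ _)
  where
  interchange : ∀ a b c d → a + b + (c + d) ≡ a + c + (b + d)
  interchange = solve-∀

∑-*ˡ : ∀ (xs : List A) c f → ∑[ x ∈ xs ] (c * f x) ≡ c * ∑ xs f
∑-*ˡ []       c f = sym (ℤ.*-zeroʳ c)
∑-*ˡ (x ∷ xs) c f = trans (cong (_+_ (c * f x)) (∑-*ˡ xs c f)) (sym (ℤ.*-distribˡ-+ c (f x) _))

∑-comm : ∀ (xs : List A) (ys : List B) (f : A → B → ℤ) →
  ∑[ x ∈ xs ] ∑[ y ∈ ys ] f x y ≡ ∑[ y ∈ ys ] ∑[ x ∈ xs ] f x y
∑-comm []       ys f = sym (∑-zero ys λ _ → refl)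
∑-comm (x ∷ xs) ys f = trans (cong (_+_ (∑ ys (f x))) (∑-comm xs ys f)) (sym (∑-+ ys (f x) _))

∑-filterᵇ : ∀ (p : A → Bool) xs f → ∑ (filterᵇ p xs) f ≡ ∑[ x ∈ xs ] (ind (p x) * f x)
∑-filterᵇ p []       f = refl
∑-filterᵇ p (x ∷ xs) f with p x
... | true  = cong₂ _+_ (sym (ℤ.*-identityˡ (f x))) (∑-filterᵇ p xs f)
... | false = trans (∑-filterᵇ p xs f) (sym (ℤ.+-identityˡ _))

length-∑ : ∀ (xs : List A) → + length xs ≡ ∑[ x ∈ xs ] + 1
length-∑ []       = refl
length-∑ (x ∷ xs) = trans (ℤ.pos-+ 1 (length xs)) (cong (_+_ (+ 1)) (length-∑ xs))

length-filterᵇ : ∀ (p : A → Bool) xs → + length (filterᵇ p xs) ≡ ∑[ x ∈ xs ] ind (p x)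
length-filterᵇ p xs = begin
  + length (filterᵇ p xs)              ≡⟨ length-∑ (filterᵇ p xs) ⟩
  ∑[ x ∈ filterᵇ p xs ] + 1            ≡⟨ ∑-filterᵇ p xs _ ⟩
  ∑[ x ∈ xs ] (ind (p x) * + 1)        ≡⟨ ∑-cong xs (λ x → ℤ.*-identityʳ (ind (p x))) ⟩
  ∑[ x ∈ xs ] ind (p x)                ∎
  where open ≡-Reasoning

module _ (_≟_ : DecidableEquality A) where

  δ : A → A → ℤ
  δ x y = ind (does (x ≟ y))

  ∑-δ : ∀ {xs} → Unique xs → ∀ {y} → y ∈ xs → (g : A → ℤ) → ∑[ x ∈ xs ] (δ x y * g x) ≡ g y
  ∑-δ {x ∷ xs} (x∉ ∷ u) (here refl) g with x ≟ x
  ... | no x≢x = ⊥-elim (x≢x refl)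
  ... | yes _  = trans (cong₂ _+_ (ℤ.*-identityˡ (g x)) (∑-zero xs vanish)) (ℤ.+-identityʳ (g x))
    where
    vanish : ∀ {z} → z ∈ xs → δ z x * g z ≡ + 0
    vanish {z} z∈ with z ≟ x
    ... | yes refl = ⊥-elim (All.lookup x∉ z∈ refl)
    ... | no _     = refl
  ∑-δ {x ∷ xs} (x∉ ∷ u) {y} (there y∈) g with x ≟ y
  ... | yes refl = ⊥-elim (All.lookup x∉ y∈ refl)
  ... | no _     = trans (ℤ.+-identityˡ _) (∑-δ u y∈ g)

  ∑-involution : ∀ {xs} → Unique xs → (∀ x → x ∈ xs) → (φ : A → A) → (∀ x → φ (φ x) ≡ x) →
    ∀ f → ∑[ s ∈ xs ] f (φ s) ≡ ∑ xs f
  ∑-involution {xs} u complete φ φφ f = begin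
    ∑[ s ∈ xs ] f (φ s)                          ≡⟨ ∑-cong xs (λ s → sym (∑-δ u (complete (φ s)) f)) ⟩
    ∑[ s ∈ xs ] ∑[ x ∈ xs ] (δ x (φ s) * f x)    ≡⟨ ∑-comm xs xs _ ⟩
    ∑[ x ∈ xs ] ∑[ s ∈ xs ] (δ x (φ s) * f x)    ≡⟨ ∑-cong xs (λ x → ∑-cong xs λ s → cong (_* f x) (δ-φ x s)) ⟩
    ∑[ x ∈ xs ] ∑[ s ∈ xs ] (δ s (φ x) * f x)    ≡⟨ ∑-cong xs (λ x → ∑-δ u (complete (φ x)) (λ _ → f x)) ⟩
    ∑ xs f                                       ∎
    where
    open ≡-Reasoning
    δ-φ : ∀ x s → δ x (φ s) ≡ δ s (φ x)
    δ-φ x s with x ≟ φ s | s ≟ φ x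
    ... | yes _    | yes _    = refl
    ... | no _     | no _     = refl
    ... | yes refl | no s≢φx  = ⊥-elim (s≢φx (sym (φφ s)))
    ... | no x≢φs  | yes refl = ⊥-elim (x≢φs (sym (φφ x)))

∑-map : ∀ (g : A → B) xs f → ∑ (map g xs) f ≡ ∑[ x ∈ xs ] f (g x)
∑-map g []       f = refl
∑-map g (x ∷ xs) f = cong (_+_ (f (g x))) (∑-map g xs f)

∑-allSubsets-suc : ∀ n f → ∑ (allSubsets (suc n)) f ≡
  (∑[ S ∈ allSubsets n ] f (false ∷ S)) + (∑[ S ∈ allSubsets n ] f (true ∷ S))
∑-allSubsets-suc n f = trans (∑-++ (map (false ∷_) (allSubsets n)) _ f)
  (cong₂ _+_ (∑-map (false ∷_) (allSubsets n) f) (∑-map (true ∷_) (allSubsets n) f))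

∑-allFin-suc : ∀ n f → ∑ (List.allFin (suc n)) f ≡ f zero + (∑[ i ∈ List.allFin n ] f (suc i))
∑-allFin-suc n f = cong (_+_ (f zero))
  (trans (cong (λ is → ∑ is f) (sym (List.map-tabulate id suc))) (∑-map suc (List.allFin n) f))

∣∣-∑ : ∀ {n} (V : Subset n) → + ∣ V ∣ ≡ ∑[ i ∈ List.allFin n ] ind (lookup V i)
∣∣-∑ []          = refl
∣∣-∑ {suc n} (true ∷ V)  = trans (ℤ.pos-+ 1 ∣ V ∣)
  (trans (cong (_+_ (+ 1)) (∣∣-∑ V)) (sym (∑-allFin-suc n (ind ∘ lookup (true ∷ V)))))
∣∣-∑ {suc n} (false ∷ V) = trans (∣∣-∑ V)
  (sym (trans (∑-allFin-suc n (ind ∘ lookup (false ∷ V))) (ℤ.+-identityˡ _)))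

∑-allSubsets-involution : ∀ {n} (φ : Subset n → Subset n) → (∀ S → φ (φ S) ≡ S) →
  ∀ f → ∑[ S ∈ allSubsets n ] f (φ S) ≡ ∑ (allSubsets n) f
∑-allSubsets-involution {n} = ∑-involution (Vec.≡-dec Bool._≟_) (allSubsets-unique n) ∈-allSubsets

∑-allFin-involution : ∀ {n} (φ : Fin n → Fin n) → (∀ i → φ (φ i) ≡ i) →
  ∀ f → ∑[ i ∈ List.allFin n ] f (φ i) ≡ ∑ (List.allFin n) f
∑-allFin-involution {n} = ∑-involution Fin._≟_ (Unique.allFin⁺ n) ∈-allFin

∣tabulate∣-∑ : ∀ {n} (f : Fin n → Bool) → + ∣ tabulate f ∣ ≡ ∑[ i ∈ List.allFin n ] ind (f i)
∣tabulate∣-∑ f = trans (∣∣-∑ (tabulate f)) (∑-cong (List.allFin _) λ i → cong ind (lookup∘tabulate f i))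

∣tabulate∣-cong : ∀ {n} {f g : Fin n → Bool} → (∀ i → f i ≡ g i) → ∣ tabulate f ∣ ≡ ∣ tabulate g ∣
∣tabulate∣-cong e = cong ∣_∣ (Vec.tabulate-cong e)

∣tabulate∣-true : ∀ n → ∣ tabulate {n = n} (λ _ → true) ∣ ≡ n
∣tabulate∣-true n = ℤ.+-injective (trans (∣tabulate∣-∑ {n} (λ _ → true))
  (trans (sym (length-∑ (List.allFin n))) (cong +_ (List.length-tabulate {n = n} id))))

∣tabulate∣-involution : ∀ {n} (σ : Fin n → Fin n) → (∀ i → σ (σ i) ≡ i) → ∀ f → ∣ tabulate (f ∘ σ) ∣ ≡ ∣ tabulate f ∣
∣tabulate∣-involution σ σσ f = ℤ.+-injective (trans (∣tabulate∣-∑ (f ∘ σ))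
  (trans (∑-allFin-involution σ σσ (ind ∘ f)) (sym (∣tabulate∣-∑ f))))

∣tabulate∣-+ : ∀ {n} (f g h : Fin n → Bool) → (∀ i → ind (f i) + ind (g i) ≡ ind (h i)) →
  ∣ tabulate f ∣ +ⁿ ∣ tabulate g ∣ ≡ ∣ tabulate h ∣
∣tabulate∣-+ {n} f g h e = ℤ.+-injective (begin
  + (∣ tabulate f ∣ +ⁿ ∣ tabulate g ∣)                ≡⟨ ℤ.pos-+ ∣ tabulate f ∣ ∣ tabulate g ∣ ⟩
  + ∣ tabulate f ∣ + + ∣ tabulate g ∣                  ≡⟨ cong₂ _+_ (∣tabulate∣-∑ f) (∣tabulate∣-∑ g) ⟩
  (∑[ i ∈ List.allFin n ] ind (f i)) + (∑[ i ∈ List.allFin n ] ind (g i)) ≡⟨ ∑-+ (List.allFin n) _ _ ⟨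
  ∑[ i ∈ List.allFin n ] (ind (f i) + ind (g i))      ≡⟨ ∑-cong (List.allFin n) e ⟩
  ∑[ i ∈ List.allFin n ] ind (h i)                    ≡⟨ ∣tabulate∣-∑ h ⟨
  + ∣ tabulate h ∣                                    ∎)
  where open ≡-Reasoning

#subsets : ∀ {n} → Subset n → ℕ → ℤ
#subsets {n} S m = ∑[ G ∈ allSubsets n ] ind ((∣ G ∣ ≡ᵇ m) ∧ (G ⊆ᵇ S))

#supersets : ∀ {n} → Subset n → ℕ → ℤ
#supersets {n} U k = ∑[ S ∈ allSubsets n ] ind ((∣ S ∣ ≡ᵇ k) ∧ (U ⊆ᵇ S))

pascal : ∀ m j → + (m C suc j) + + (m C j) ≡ + (suc m C suc j)
pascal m j = trans (sym (ℤ.pos-+ (m C suc j) (m C j)))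
  (cong +_ (trans (ℕ.+-comm (m C suc j) (m C j)) (nCk+nC[k+1]≡[n+1]C[k+1] m j)))

#subsets≡C : ∀ {n} (S : Subset n) m → #subsets S m ≡ + (∣ S ∣ C m)
#subsets≡C []          zero    = refl
#subsets≡C []          (suc m) = refl
#subsets≡C {suc n} (false ∷ S) m = begin
  #subsets (false ∷ S) m                      ≡⟨ ∑-allSubsets-suc n _ ⟩
  #subsets S m + (∑[ G ∈ allSubsets n ] ind ((∣ true ∷ G ∣ ≡ᵇ m) ∧ false))
    ≡⟨ cong (_+_ (#subsets S m)) (∑-zero (allSubsets n) λ {G} _ → cong ind (∧-zeroʳ (∣ true ∷ G ∣ ≡ᵇ m))) ⟩
  #subsets S m + + 0                          ≡⟨ ℤ.+-identityʳ _ ⟩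
  #subsets S m                                ≡⟨ #subsets≡C S m ⟩
  + (∣ S ∣ C m)                               ∎
  where open ≡-Reasoning
#subsets≡C {suc n} (true ∷ S) zero = trans (∑-allSubsets-suc n _)
  (trans (cong₂ _+_ (#subsets≡C S 0) (∑-zero (allSubsets n) λ _ → refl)) (ℤ.+-identityʳ _))
#subsets≡C {suc n} (true ∷ S) (suc m) = trans (∑-allSubsets-suc n _)
  (trans (cong₂ _+_ (#subsets≡C S (suc m)) (#subsets≡C S m)) (pascal ∣ S ∣ m))

#supersets-excess : ∀ {n} (U : Subset n) j → #supersets U (∣ U ∣ +ⁿ j) ≡ + ((n ∸ ∣ U ∣) C j)
#supersets-excess []          zero    = refl
#supersets-excess []          (suc j) = refl
#supersets-excess {suc n} (true ∷ U) j = begin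
  #supersets (true ∷ U) (suc (∣ U ∣ +ⁿ j))     ≡⟨ ∑-allSubsets-suc n _ ⟩
  (∑[ S ∈ allSubsets n ] ind ((∣ S ∣ ≡ᵇ suc (∣ U ∣ +ⁿ j)) ∧ false)) + #supersets U (∣ U ∣ +ⁿ j)
    ≡⟨ cong (_+ #supersets U (∣ U ∣ +ⁿ j)) (∑-zero (allSubsets n) λ {S} _ → cong ind (∧-zeroʳ (∣ S ∣ ≡ᵇ suc (∣ U ∣ +ⁿ j)))) ⟩
  + 0 + #supersets U (∣ U ∣ +ⁿ j)             ≡⟨ ℤ.+-identityˡ _ ⟩
  #supersets U (∣ U ∣ +ⁿ j)                   ≡⟨ #supersets-excess U j ⟩
  + ((n ∸ ∣ U ∣) C j)                        ∎
  where open ≡-Reasoning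
#supersets-excess {suc n} (false ∷ U) zero = begin
  #supersets (false ∷ U) (∣ U ∣ +ⁿ 0)          ≡⟨ ∑-allSubsets-suc n _ ⟩
  #supersets U (∣ U ∣ +ⁿ 0) + (∑[ S ∈ allSubsets n ] ind ((suc ∣ S ∣ ≡ᵇ ∣ U ∣ +ⁿ 0) ∧ (U ⊆ᵇ S)))
    ≡⟨ cong₂ _+_ (#supersets-excess U 0) (∑-zero (allSubsets n) λ {S} _ → no-smaller-superset S) ⟩
  + ((n ∸ ∣ U ∣) C 0) + + 0                  ≡⟨ cong +_ (trans (ℕ.+-identityʳ _) (trans (nC0≡1 (n ∸ ∣ U ∣)) (sym (nC0≡1 (suc n ∸ ∣ U ∣))))) ⟩
  + ((suc n ∸ ∣ U ∣) C 0)                    ∎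
  where
  open ≡-Reasoning
  nC0≡1 : ∀ m → m C 0 ≡ 1
  nC0≡1 zero    = refl
  nC0≡1 (suc m) = refl
  no-smaller-superset : ∀ S → ind ((suc ∣ S ∣ ≡ᵇ ∣ U ∣ +ⁿ 0) ∧ (U ⊆ᵇ S)) ≡ + 0
  no-smaller-superset S with T-dec (U ⊆ᵇ S)
  ... | inj₂ U⊈S = cong ind (trans (cong ((suc ∣ S ∣ ≡ᵇ ∣ U ∣ +ⁿ 0) ∧_) (to T-not-≡ (from T-not U⊈S))) (∧-zeroʳ _))
  ... | inj₁ U⊆S = cong (λ b → ind (b ∧ (U ⊆ᵇ S))) (to T-not-≡ (from T-not size≢))
    where
    size≢ : ¬ T (suc ∣ S ∣ ≡ᵇ ∣ U ∣ +ⁿ 0)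
    size≢ h = ℕ.<⇒≱ (ℕ.≤-reflexive (ℕ.≡ᵇ⇒≡ _ _ h)) (ℕ.≤-trans (ℕ.≤-reflexive (ℕ.+-identityʳ _))
                (∣∣-mono U S (⊆ᵇ⁻ U S U⊆S)))
#supersets-excess {suc n} (false ∷ U) (suc j) = begin
  #supersets (false ∷ U) (∣ U ∣ +ⁿ suc j)
    ≡⟨ ∑-allSubsets-suc n _ ⟩
  #supersets U (∣ U ∣ +ⁿ suc j) + (∑[ S ∈ allSubsets n ] ind ((suc ∣ S ∣ ≡ᵇ ∣ U ∣ +ⁿ suc j) ∧ (U ⊆ᵇ S)))
    ≡⟨ cong (_+_ (#supersets U (∣ U ∣ +ⁿ suc j))) (cong (λ k → ∑[ S ∈ allSubsets n ] ind ((suc ∣ S ∣ ≡ᵇ k) ∧ (U ⊆ᵇ S))) (ℕ.+-suc ∣ U ∣ j)) ⟩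
  #supersets U (∣ U ∣ +ⁿ suc j) + #supersets U (∣ U ∣ +ⁿ j)
    ≡⟨ cong₂ _+_ (#supersets-excess U (suc j)) (#supersets-excess U j) ⟩
  + ((n ∸ ∣ U ∣) C suc j) + + ((n ∸ ∣ U ∣) C j)
    ≡⟨ pascal (n ∸ ∣ U ∣) j ⟩
  + (suc (n ∸ ∣ U ∣) C suc j)
    ≡⟨ cong (λ m → + (m C suc j)) (sym (ℕ.+-∸-assoc 1 (∣p∣≤n U))) ⟩
  + ((suc n ∸ ∣ U ∣) C suc j)                ∎
  where open ≡-Reasoning

#supersets≡C : ∀ {n} (U : Subset n) {k} → ∣ U ∣ ≤ k → #supersets U k ≡ + ((n ∸ ∣ U ∣) C (k ∸ ∣ U ∣))
#supersets≡C U {k} U≤k =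
  subst (λ k′ → #supersets U k′ ≡ + (_ C (k ∸ ∣ U ∣))) (ℕ.m+[n∸m]≡n U≤k) (#supersets-excess U (k ∸ ∣ U ∣))

count : (A → Bool) → List A → ℕ
count Q xs = length (filterᵇ Q xs)

module _ (_≟_ : DecidableEquality A) {xs : List A} (unique : Unique xs) where

  count-remove : ∀ {Q x₀} → x₀ ∈ xs → T (Q x₀) → count Q xs ≡ suc (count (λ x → Q x ∧ not (does (x ≟ x₀))) xs)
  count-remove {Q} {x₀} x₀∈ q₀ = ℤ.+-injective (begin
    + count Q xs                                     ≡⟨ length-filterᵇ Q xs ⟩
    ∑[ x ∈ xs ] ind (Q x)                            ≡⟨ ∑-cong xs split ⟩
    ∑[ x ∈ xs ] (δ _≟_ x x₀ * + 1 + ind (Q′ x))      ≡⟨ ∑-+ xs _ _ ⟩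
    (∑[ x ∈ xs ] (δ _≟_ x x₀ * + 1)) + (∑[ x ∈ xs ] ind (Q′ x))
                                                     ≡⟨ cong₂ _+_ (∑-δ _≟_ unique x₀∈ _) (sym (length-filterᵇ Q′ xs)) ⟩
    + 1 + + count Q′ xs                              ≡⟨ sym (ℤ.pos-+ 1 _) ⟩
    + suc (count Q′ xs)                              ∎)
    where
    open ≡-Reasoning
    Q′ : A → Bool
    Q′ x = Q x ∧ not (does (x ≟ x₀))
    split : ∀ x → ind (Q x) ≡ δ _≟_ x x₀ * + 1 + ind (Q′ x)
    split x with x ≟ x₀
    ... | yes refl rewrite to T-≡ q₀ = refl
    ... | no _ with Q x
    ...   | true  = refl
    ...   | false = refl

  injection⇒∣∣≤count : (∀ x → x ∈ xs) → ∀ {a} (V : Subset a) (f : Fin a → A) {Q : A → Bool} →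
    (∀ {i j} → T (lookup V i) → T (lookup V j) → f i ≡ f j → i ≡ j) →
    (∀ i → T (lookup V i) → T (Q (f i))) → ∣ V ∣ ≤ count Q xs
  injection⇒∣∣≤count complete []          f inj maps = z≤n
  injection⇒∣∣≤count complete (false ∷ V) f inj maps =
    injection⇒∣∣≤count complete V (f ∘ suc) (λ p q e → FinP.suc-injective (inj p q e)) (maps ∘ suc)
  injection⇒∣∣≤count complete (true ∷ V)  f {Q} inj maps =
    subst (suc ∣ V ∣ ≤_) (sym (count-remove (complete (f zero)) (maps zero tt)))
      (s≤s (injection⇒∣∣≤count complete V (f ∘ suc) (λ p q e → FinP.suc-injective (inj p q e)) maps′))
    where
    maps′ : ∀ i → T (lookup V i) → T (Q (f (suc i)) ∧ not (does (f (suc i) ≟ f zero)))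
    maps′ i v with f (suc i) ≟ f zero
    ... | yes e = case inj {suc i} {zero} v tt e of λ ()
    ... | no _  = from T-∧ (maps (suc i) v , tt)

-- Signed sums over covering families

∏ : ∀ {t} → (Fin t → ℤ) → ℤ
∏ {zero}  f = + 1
∏ {suc t} f = f zero * ∏ (f ∘ suc)

∏-cong : ∀ {t} {f g : Fin t → ℤ} → (∀ e → f e ≡ g e) → ∏ f ≡ ∏ g
∏-cong {zero}  e = refl
∏-cong {suc t} e = cong₂ _*_ (e zero) (∏-cong (e ∘ suc))

∏-const : ∀ t a → ∏ {t} (λ _ → a) ≡ a ^ t
∏-const zero    a = refl
∏-const (suc t) a = cong (a *_) (∏-const t a)

ind-allFin : ∀ {t} (p : Fin t → Bool) → ind (allFin p) ≡ ∏ (ind ∘ p)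
ind-allFin {zero}  p = refl
ind-allFin {suc t} p with p zero
... | true  = trans (ind-allFin (p ∘ suc)) (sym (ℤ.*-identityˡ _))
... | false = sym (ℤ.*-zeroˡ (∏ (ind ∘ p ∘ suc)))

∏-linear : ∀ {t} (f g h : Fin t → ℤ) x → (∀ e → e ≢ x → f e ≡ g e) → (∀ e → e ≢ x → g e ≡ h e) →
  f x ≡ g x - h x → ∏ f ≡ ∏ g - ∏ h
∏-linear {suc t} f g h zero f≗g g≗h fx = begin
  f zero * ∏ (f ∘ suc)                   ≡⟨ cong₂ _*_ fx (∏-cong λ e → f≗g (suc e) λ ()) ⟩
  (g zero - h zero) * ∏ (g ∘ suc)        ≡⟨ distrib (g zero) (h zero) (∏ (g ∘ suc)) ⟩
  g zero * ∏ (g ∘ suc) - h zero * ∏ (g ∘ suc)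
    ≡⟨ cong (λ P → g zero * ∏ (g ∘ suc) - h zero * P) (∏-cong λ e → g≗h (suc e) λ ()) ⟩
  g zero * ∏ (g ∘ suc) - h zero * ∏ (h ∘ suc) ∎
  where
  open ≡-Reasoning
  distrib : ∀ a b P → (a - b) * P ≡ a * P - b * P
  distrib = solve-∀
∏-linear {suc t} f g h (suc x) f≗g g≗h fx = begin
  f zero * ∏ (f ∘ suc)
    ≡⟨ cong₂ _*_ (f≗g zero λ ()) (∏-linear (f ∘ suc) (g ∘ suc) (h ∘ suc) x
         (λ e e≢x → f≗g (suc e) (e≢x ∘ FinP.suc-injective)) (λ e e≢x → g≗h (suc e) (e≢x ∘ FinP.suc-injective)) fx) ⟩
  g zero * (∏ (g ∘ suc) - ∏ (h ∘ suc))        ≡⟨ distrib (g zero) (∏ (g ∘ suc)) (∏ (h ∘ suc)) ⟩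
  g zero * ∏ (g ∘ suc) - g zero * ∏ (h ∘ suc) ≡⟨ cong (λ a → g zero * ∏ (g ∘ suc) - a * ∏ (h ∘ suc)) (g≗h zero λ ()) ⟩
  g zero * ∏ (g ∘ suc) - h zero * ∏ (h ∘ suc) ∎
  where
  open ≡-Reasoning
  distrib : ∀ a P Q → a * (P - Q) ≡ a * P - a * Q
  distrib = solve-∀

∏-single-hit : ∀ {t} (c r h : Fin t → Bool) x → T (h x) → (∀ e → T (h e) → e ≡ x) →
  ∏ (λ e → ind (c e) - ind (h e ∨ r e)) ≡ ∏ (λ e → ind (c e) - ind (r e)) - ∏ (λ e → ind (c e ∨ h e) - ind (r e))
∏-single-hit c r h x hx only-x = ∏-linear _ _ _ x same-off-x same-off-x′ at-x
  where
  misses : ∀ e → e ≢ x → h e ≡ false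
  misses e e≢x = to T-not-≡ (from T-not λ he → e≢x (only-x e he))
  same-off-x : ∀ e → e ≢ x → ind (c e) - ind (h e ∨ r e) ≡ ind (c e) - ind (r e)
  same-off-x e e≢x rewrite misses e e≢x = refl
  same-off-x′ : ∀ e → e ≢ x → ind (c e) - ind (r e) ≡ ind (c e ∨ h e) - ind (r e)
  same-off-x′ e e≢x rewrite misses e e≢x | ∨-identityʳ (c e) = refl
  at-x : ind (c x) - ind (h x ∨ r x) ≡ (ind (c x) - ind (r x)) - (ind (c x ∨ h x) - ind (r x))
  at-x rewrite to T-≡ hx | ∨-zeroʳ (c x) = cancel (ind (c x)) (ind (r x))
    where
    cancel : ∀ a b → a - + 1 ≡ (a - b) - (+ 1 - b)
    cancel = solve-∀

sign : ∀ {n} → Subset n → ℤ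
sign 𝒢 = (- (+ 1)) ^ ∣ 𝒢 ∣

within : ∀ {n} → (Fin n → Bool) → Subset n → Bool
within allowed 𝒢 = allFin (λ j → not (lookup 𝒢 j) ∨ allowed j)

module _ {n t : ℕ} where

  -- elements e with c e = true count as covered from the outset
  covers : (Fin n → Fin t → Bool) → (Fin t → Bool) → Subset n → Bool
  covers hit c 𝒢 = allFin (λ e → c e ∨ anyFin (λ j → lookup 𝒢 j ∧ hit j e))

  reached : (Fin n → Bool) → (Fin n → Fin t → Bool) → Fin t → Bool
  reached allowed hit e = anyFin (λ j → allowed j ∧ hit j e)

  covers-none⇔ : ∀ hit 𝒢 → T (covers hit (λ _ → false) 𝒢) ⇔ (∀ e → ∃ λ j → T (lookup 𝒢 j) × T (hit j e))
  covers-none⇔ hit 𝒢 = mk⇔ (λ h e → let (j , q) = anyFin⁻ (allFin⁻ h e) in j , to T-∧ q)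
                           (λ h → allFin⁺ λ e → let (j , q) = h e in anyFin⁺ j (from T-∧ q))

within⇔ : ∀ {n} (allowed : Fin n → Bool) 𝒢 → T (within allowed 𝒢) ⇔ (∀ j → T (lookup 𝒢 j) → T (allowed j))
within⇔ allowed 𝒢 = mk⇔ (λ h j → to (T-⇒ {lookup 𝒢 j}) (allFin⁻ h j))
                        (λ h → allFin⁺ λ j → from (T-⇒ {lookup 𝒢 j}) (h j))

Singleton : ∀ {t} → (Fin t → Bool) → Set
Singleton {t} h = Σ (Fin t) λ x → T (h x) × (∀ y → T (h y) → y ≡ x)

∑-sign-covers : ∀ {n t} (allowed : Fin n → Bool) (hit : Fin n → Fin t → Bool) →
  (∀ j → T (allowed j) → Singleton (hit j)) → ∀ c →
  ∑[ 𝒢 ∈ allSubsets n ] (ind (within allowed 𝒢 ∧ covers hit c 𝒢) * sign 𝒢)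
    ≡ ∏ (λ e → ind (c e) - ind (reached allowed hit e))
∑-sign-covers {zero} allowed hit one c = begin
  ind (allFin (λ e → c e ∨ false)) * + 1 + + 0  ≡⟨ trans (ℤ.+-identityʳ _) (ℤ.*-identityʳ _) ⟩
  ind (allFin (λ e → c e ∨ false))             ≡⟨ ind-allFin (λ e → c e ∨ false) ⟩
  ∏ (λ e → ind (c e ∨ false))                  ≡⟨ ∏-cong (λ e → trans (cong ind (∨-identityʳ (c e))) (sym (ℤ.+-identityʳ _))) ⟩
  ∏ (λ e → ind (c e) - + 0)                    ∎
  where open ≡-Reasoning
∑-sign-covers {suc n} {t} allowed hit one c with allowed zero in eq
... | false = trans (∑-allSubsets-suc n _)
  (trans (cong₂ _+_ (∑-sign-covers allowed′ hit′ (one ∘ suc) c) (∑-zero (allSubsets n) λ {𝒢} _ → ℤ.*-zeroˡ (sign (true ∷ 𝒢))))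
         (ℤ.+-identityʳ _))
  where
  allowed′ = allowed ∘ suc
  hit′ = hit ∘ suc
... | true with one zero (subst T (sym eq) tt)
...   | x , hits-x , only-x = trans (∑-allSubsets-suc n _) (begin
  (∑[ 𝒢 ∈ allSubsets n ] (ind (within allowed′ 𝒢 ∧ covers hit′ c 𝒢) * sign 𝒢))
    + (∑[ 𝒢 ∈ allSubsets n ] (ind (within allowed′ 𝒢 ∧ covers hit c (true ∷ 𝒢)) * sign (true ∷ 𝒢)))
    ≡⟨ cong₂ _+_ (∑-sign-covers allowed′ hit′ (one ∘ suc) c) with-zero ⟩
  ∏ (λ e → ind (c e) - ind (reached′ e)) + - ∏ (λ e → ind (c′ e) - ind (reached′ e))
    ≡⟨ ∏-single-hit c reached′ (hit zero) x hits-x only-x ⟨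
  ∏ (λ e → ind (c e) - ind (hit zero e ∨ reached′ e)) ∎)
  where
  open ≡-Reasoning
  allowed′ = allowed ∘ suc
  hit′ = hit ∘ suc
  reached′ = reached allowed′ hit′
  c′ : Fin t → Bool
  c′ e = c e ∨ hit zero e
  -- families containing index zero cover x in advance and carry an extra factor -1
  with-zero : ∑[ 𝒢 ∈ allSubsets n ] (ind (within allowed′ 𝒢 ∧ covers hit c (true ∷ 𝒢)) * sign (true ∷ 𝒢))
              ≡ - ∏ (λ e → ind (c′ e) - ind (reached′ e))
  with-zero = begin
    ∑[ 𝒢 ∈ allSubsets n ] (ind (within allowed′ 𝒢 ∧ covers hit c (true ∷ 𝒢)) * sign (true ∷ 𝒢))
      ≡⟨ ∑-cong (allSubsets n) (λ 𝒢 → trans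
           (cong (λ b → ind (within allowed′ 𝒢 ∧ b) * sign (true ∷ 𝒢)) (allFin-cong λ e → sym (∨-assoc (c e) (hit zero e) _)))
           (swap (ind (within allowed′ 𝒢 ∧ covers hit′ c′ 𝒢)) (sign 𝒢))) ⟩
    ∑[ 𝒢 ∈ allSubsets n ] (- (+ 1) * (ind (within allowed′ 𝒢 ∧ covers hit′ c′ 𝒢) * sign 𝒢))
      ≡⟨ ∑-*ˡ (allSubsets n) (- (+ 1)) _ ⟩
    - (+ 1) * (∑[ 𝒢 ∈ allSubsets n ] (ind (within allowed′ 𝒢 ∧ covers hit′ c′ 𝒢) * sign 𝒢))
      ≡⟨ cong (- (+ 1) *_) (∑-sign-covers allowed′ hit′ (one ∘ suc) c′) ⟩
    - (+ 1) * ∏ (λ e → ind (c′ e) - ind (reached′ e))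
      ≡⟨ ℤ.-1*i≡-i _ ⟩
    - ∏ (λ e → ind (c′ e) - ind (reached′ e)) ∎
    where
    swap : ∀ a s → a * (- (+ 1) * s) ≡ - (+ 1) * (a * s)
    swap = solve-∀

==ˢ-sound : ∀ {a b} → T (a ==ˢ b) → a ≡ b
==ˢ-sound {⊕} {⊕} _ = refl
==ˢ-sound {⊖} {⊖} _ = refl
==ˢ-sound {𝟘} {𝟘} _ = refl

==ˢ-refl : ∀ a → T (a ==ˢ a)
==ˢ-refl ⊕ = tt
==ˢ-refl ⊖ = tt
==ˢ-refl 𝟘 = tt

sign-dec : ∀ s → s ≡ 𝟘 ⊎ s ≢ 𝟘
sign-dec ⊕ = inj₂ λ ()
sign-dec ⊖ = inj₂ λ ()
sign-dec 𝟘 = inj₁ refl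

isNonzero⇔ : ∀ {s} → T (isNonzero s) ⇔ s ≢ 𝟘
isNonzero⇔ {⊕} = mk⇔ (λ _ ()) (λ _ → tt)
isNonzero⇔ {⊖} = mk⇔ (λ _ ()) (λ _ → tt)
isNonzero⇔ {𝟘} = mk⇔ (λ ()) (λ h → h refl)

negˢ-involutive : ∀ s → negˢ (negˢ s) ≡ s
negˢ-involutive ⊕ = refl
negˢ-involutive ⊖ = refl
negˢ-involutive 𝟘 = refl

negˢ≡𝟘 : ∀ {s} → negˢ s ≡ 𝟘 → s ≡ 𝟘
negˢ≡𝟘 {𝟘} _ = refl

negˢ≡⊖ : ∀ {s} → negˢ s ≡ ⊖ → s ≡ ⊕
negˢ≡⊖ {⊕} _ = refl

negˢ-fixed : ∀ {s} → negˢ s ≡ s → s ≡ 𝟘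
negˢ-fixed {𝟘} _ = refl

*ˢ-zeroʳ : ∀ s → s *ˢ 𝟘 ≡ 𝟘
*ˢ-zeroʳ ⊕ = refl
*ˢ-zeroʳ ⊖ = refl
*ˢ-zeroʳ 𝟘 = refl

*ˢ-negˡ : ∀ a b → negˢ a *ˢ b ≡ negˢ (a *ˢ b)
*ˢ-negˡ ⊕ ⊕ = refl
*ˢ-negˡ ⊕ ⊖ = refl
*ˢ-negˡ ⊕ 𝟘 = refl
*ˢ-negˡ ⊖ ⊕ = refl
*ˢ-negˡ ⊖ ⊖ = refl
*ˢ-negˡ ⊖ 𝟘 = refl
*ˢ-negˡ 𝟘 b = refl

*ˢ-negʳ : ∀ a b → a *ˢ negˢ b ≡ negˢ (a *ˢ b)
*ˢ-negʳ ⊕ ⊕ = refl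
*ˢ-negʳ ⊕ ⊖ = refl
*ˢ-negʳ ⊕ 𝟘 = refl
*ˢ-negʳ ⊖ ⊕ = refl
*ˢ-negʳ ⊖ ⊖ = refl
*ˢ-negʳ ⊖ 𝟘 = refl
*ˢ-negʳ 𝟘 b = refl

*ˢ≢⊖⇒≡ : ∀ {a b} → a ≢ 𝟘 → b ≢ 𝟘 → a *ˢ b ≢ ⊖ → b ≡ a
*ˢ≢⊖⇒≡ {⊕} {⊕} _ _ _ = refl
*ˢ≢⊖⇒≡ {⊖} {⊖} _ _ _ = refl
*ˢ≢⊖⇒≡ {⊕} {⊖} _ _ h = ⊥-elim (h refl)
*ˢ≢⊖⇒≡ {⊖} {⊕} _ _ h = ⊥-elim (h refl)
*ˢ≢⊖⇒≡ {𝟘}     h _ _ = ⊥-elim (h refl)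
*ˢ≢⊖⇒≡ {_} {𝟘} _ h _ = ⊥-elim (h refl)

isNonzero-negˢ : ∀ s → isNonzero (negˢ s) ≡ isNonzero s
isNonzero-negˢ ⊕ = refl
isNonzero-negˢ ⊖ = refl
isNonzero-negˢ 𝟘 = refl

isPos-negˢ : ∀ s → isPos (negˢ s) ≡ isNeg s
isPos-negˢ ⊕ = refl
isPos-negˢ ⊖ = refl
isPos-negˢ 𝟘 = refl

isNeg-negˢ : ∀ s → isNeg (negˢ s) ≡ isPos s
isNeg-negˢ ⊕ = refl
isNeg-negˢ ⊖ = refl
isNeg-negˢ 𝟘 = refl

conformal-negˢ : ∀ x y → ((negˢ x ==ˢ 𝟘) ∨ (negˢ x ==ˢ negˢ y)) ≡ ((x ==ˢ 𝟘) ∨ (x ==ˢ y))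
conformal-negˢ ⊕ ⊕ = refl
conformal-negˢ ⊕ ⊖ = refl
conformal-negˢ ⊕ 𝟘 = refl
conformal-negˢ ⊖ ⊕ = refl
conformal-negˢ ⊖ ⊖ = refl
conformal-negˢ ⊖ 𝟘 = refl
conformal-negˢ 𝟘 y = refl

lookup-negᵛ : ∀ {t} (X : SignVec t) f → lookup (negᵛ X) f ≡ negˢ (lookup X f)
lookup-negᵛ X f = Vec.lookup-map f negˢ X

lookup-ext : ∀ {n} (U V : Vec A n) → (∀ i → lookup U i ≡ lookup V i) → U ≡ V
lookup-ext U V h = trans (sym (Vec.tabulate∘lookup U)) (trans (Vec.tabulate-cong h) (Vec.tabulate∘lookup V))

negᵛ-involutive : ∀ {t} (X : SignVec t) → negᵛ (negᵛ X) ≡ X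
negᵛ-involutive X = lookup-ext _ X λ f →
  trans (lookup-negᵛ (negᵛ X) f) (trans (cong negˢ (lookup-negᵛ X f)) (negˢ-involutive _))

module Orthogonality {t : ℕ} (M : OrientedMatroid t) where

  open OrientedMatroid M

  _·_ : SignVec t → SignVec t → Fin t → Sign
  (W · Y) f = lookup W f *ˢ lookup Y f

  orth-cong : ∀ W₁ W₂ Y → (∀ f → (W₁ · Y) f ≡ (W₂ · Y) f) → orthᵇ M W₁ Y ≡ orthᵇ M W₂ Y
  orth-cong W₁ W₂ Y h = cong₂ _∨_ (cong not (anyFin-cong (cong isNonzero ∘ h)))
    (cong₂ _∧_ (anyFin-cong (cong isPos ∘ h)) (anyFin-cong (cong isNeg ∘ h)))

  orth-nonneg⇒zero : ∀ W Y → T (orthᵇ M W Y) → (∀ f → (W · Y) f ≢ ⊖) → ∀ f → (W · Y) f ≡ 𝟘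
  orth-nonneg⇒zero W Y orth nonneg f with to (T-∨ {not (anyFin (isNonzero ∘ (W · Y)))}) orth
  ... | inj₁ none = [ id , (λ ≢𝟘 → ⊥-elim (to T-not none (anyFin⁺ f (from isNonzero⇔ ≢𝟘)))) ]′ (sign-dec ((W · Y) f))
  ... | inj₂ pos-neg = let (g , neg) = anyFin⁻ (proj₂ (to (T-∧ {anyFin (isPos ∘ (W · Y))}) pos-neg))
                       in ⊥-elim (nonneg g (==ˢ-sound neg))

  ¬orth⇒one-signed : ∀ W Y → ¬ T (orthᵇ M W Y) → (∀ f → (W · Y) f ≢ ⊕) ⊎ (∀ f → (W · Y) f ≢ ⊖)
  ¬orth⇒one-signed W Y ¬orth with T-dec (anyFin (isPos ∘ (W · Y)))
  ... | inj₂ ¬pos = inj₁ λ f eq → ¬pos (anyFin⁺ f (subst (T ∘ isPos) (sym eq) tt))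
  ... | inj₁ pos  = inj₂ λ f eq → ¬orth (from (T-∨ {not (anyFin (isNonzero ∘ (W · Y)))})
                      (inj₂ (from T-∧ (pos , anyFin⁺ f (subst (T ∘ isNeg) (sym eq) tt)))))

  covector⇔ : ∀ W → T (isCovector M W) ⇔ (∀ Y → T (isCircuit Y) → T (orthᵇ M W Y))
  covector⇔ W = mk⇔ (λ h Y c → to (T-⇒ {isCircuit Y}) (allList⁻ {xs = allSignVecs t} h (∈-allSignVecs Y)) c)
                    (λ h → allList⁺ {xs = allSignVecs t} λ {Y} _ → from (T-⇒ {isCircuit Y}) (h Y))

-- Topes of a simple oriented matroid have full support

_∖_ : ∀ {t} → (Fin t → Bool) → Fin t → Fin t → Bool
(R ∖ e) f = R f ∧ not (does (f Fin.≟ e))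

∖⁺ : ∀ {t} (R : Fin t → Bool) {e f} → f ≢ e → T (R f) → T ((R ∖ e) f)
∖⁺ R {e} {f} f≢e r with f Fin.≟ e
... | yes f≡e = ⊥-elim (f≢e f≡e)
... | no _    = from T-∧ (r , tt)

∖⁻ : ∀ {t} (R : Fin t → Bool) {e f} → T ((R ∖ e) f) → T (R f) × f ≢ e
∖⁻ R {e} {f} h with f Fin.≟ e | to (T-∧ {R f}) h
... | no f≢e | r , _ = r , f≢e

module Extension {t : ℕ} (M : OrientedMatroid t) (simple : Simple M) (X : SignVec t) where

  open OrientedMatroid M
  open Orthogonality M

  Avoids : (Fin t → Bool) → SignVec t → Set
  Avoids R Y = ∀ f → T (R f) → lookup Y f ≡ 𝟘

  -- R holds the coordinates of W still to be made nonzero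
  record Extends (R : Fin t → Bool) (W : SignVec t) : Set where
    field
      conformal  : ∀ f → lookup X f ≡ 𝟘 ⊎ lookup X f ≡ lookup W f
      nonzero    : ∀ f → ¬ T (R f) → lookup W f ≢ 𝟘
      X-zero     : ∀ f → T (R f) → lookup X f ≡ 𝟘
      orthogonal : ∀ Y → T (isCircuit Y) → Avoids R Y → T (orthᵇ M W Y)

  -- a circuit witnessing that W cannot be extended by W e = s
  record Obstruction (R : Fin t → Bool) (W : SignVec t) (e : Fin t) (s : Sign) : Set where
    field
      Y        : SignVec t
      circuit  : T (isCircuit Y)
      avoids   : Avoids (R ∖ e) Y
      at-e     : lookup Y e ≡ s
      conforms : ∀ f → f ≢ e → lookup Y f ≡ 𝟘 ⊎ lookup Y f ≡ lookup W f

  module _ {R W} (ext : Extends R W) {e} (e∈R : T (R e)) where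

    open Extends ext

    obstruction : ∀ {s} → s ≢ 𝟘 → ∀ Y → T (isCircuit Y) → Avoids (R ∖ e) Y →
                  ¬ T (orthᵇ M (W [ e ]≔ s) Y) → Obstruction R W e s
    obstruction {s} s≢𝟘 Y circ avoids ¬orth = [ by-negation , conforming Y circ avoids Ye≢𝟘 ]′
                                                  (¬orth⇒one-signed (W [ e ]≔ s) Y ¬orth)
      where
      -- a circuit vanishing at e avoids R, so W, and hence W [ e ]≔ s, would be orthogonal to it
      Ye≢𝟘 : lookup Y e ≢ 𝟘
      Ye≢𝟘 Ye≡𝟘 = ¬orth (subst T (orth-cong W (W [ e ]≔ s) Y same-products) (orthogonal Y circ avoids-R))
        where
        avoids-R : Avoids R Y
        avoids-R f r with f Fin.≟ e
        ... | yes refl = Ye≡𝟘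
        ... | no f≢e   = avoids f (∖⁺ R f≢e r)
        same-products : ∀ f → (W · Y) f ≡ ((W [ e ]≔ s) · Y) f
        same-products f with f Fin.≟ e
        ... | yes refl rewrite Ye≡𝟘 = trans (*ˢ-zeroʳ _) (sym (*ˢ-zeroʳ _))
        ... | no f≢e   = cong (_*ˢ lookup Y f) (sym (Vec.lookup∘update′ f≢e W s))
      conforming : ∀ Y′ → T (isCircuit Y′) → Avoids (R ∖ e) Y′ → lookup Y′ e ≢ 𝟘 →
                   (∀ f → ((W [ e ]≔ s) · Y′) f ≢ ⊖) → Obstruction R W e s
      conforming Y′ circ′ avoids′ Y′e≢𝟘 nonneg = record
        { Y = Y′ ; circuit = circ′ ; avoids = avoids′
        ; at-e = *ˢ≢⊖⇒≡ s≢𝟘 Y′e≢𝟘 (λ eq → nonneg e (trans (cong (_*ˢ lookup Y′ e) (Vec.lookup∘update e W s)) eq))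
        ; conforms = λ f f≢e → [ inj₁ , (λ Y′f≢𝟘 → inj₂ (*ˢ≢⊖⇒≡
            (nonzero f λ r → Y′f≢𝟘 (avoids′ f (∖⁺ R f≢e r))) Y′f≢𝟘
            (λ eq → nonneg f (trans (cong (_*ˢ lookup Y′ f) (Vec.lookup∘update′ f≢e W s)) eq)))) ]′ (sign-dec (lookup Y′ f)) }
      by-negation : (∀ f → ((W [ e ]≔ s) · Y) f ≢ ⊕) → Obstruction R W e s
      by-negation nonpos = conforming (negᵛ Y) (C1 Y circ)
        (λ f r → trans (lookup-negᵛ Y f) (cong negˢ (avoids f r)))
        (λ eq → Ye≢𝟘 (negˢ≡𝟘 (trans (sym (lookup-negᵛ Y e)) eq)))
        (λ f eq → nonpos f (negˢ≡⊖ (trans (sym (*ˢ-negʳ (lookup (W [ e ]≔ s) f) (lookup Y f)))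
                    (trans (cong (lookup (W [ e ]≔ s) f *ˢ_) (sym (lookup-negᵛ Y f))) eq))))

    -- all products of W with such a circuit Z are nonnegative, so orthogonality forces Z = 0, contradicting (C0)
    no-conformal-circuit : ∀ Z → T (isCircuit Z) → Avoids R Z → (∀ f → lookup Z f ≡ 𝟘 ⊎ (W · Z) f ≡ ⊕) → ⊥
    no-conformal-circuit Z Z-circuit Z-avoids W-conforms = subst T (trans (cong isCircuit Z≡𝟘) C0) Z-circuit
      where
      products-zero : ∀ f → (W · Z) f ≡ 𝟘
      products-zero = orth-nonneg⇒zero W Z (orthogonal Z Z-circuit Z-avoids) λ f eq →
        [ (λ z → case trans (sym eq) (trans (cong (lookup W f *ˢ_) z) (*ˢ-zeroʳ _)) of λ ()) , (λ p → case trans (sym p) eq of λ ()) ]′ (W-conforms f)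
      Z≡𝟘 : Z ≡ zeroᵛ
      Z≡𝟘 = lookup-ext Z zeroᵛ λ f → trans
        ([ id , (λ p → case trans (sym p) (products-zero f) of λ ()) ]′ (W-conforms f))
        (sym (Vec.lookup-replicate f 𝟘))

    -- otherwise Y would vanish off e, i.e. be a loop, which simplicity excludes
    obstructions-not-opposite : ∀ {s s′} (Ob : Obstruction R W e s) (Ob′ : Obstruction R W e s′) →
      Obstruction.Y Ob ≢ negᵛ (Obstruction.Y Ob′)
    obstructions-not-opposite Ob Ob′ Y≡-Y′ = ℕ.<⇒≱ (simple Y circuit)
      (ℕ.≤-trans (∣∣-mono (supp Y) ⁅ e ⁆ supp⊆e) (ℕ.≤-trans (ℕ.≤-reflexive (∣⁅x⁆∣≡1 e)) (ℕ.n≤1+n 1)))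
      where
      open Obstruction Ob
      open Obstruction Ob′ renaming (Y to Y′; conforms to conforms′) using ()
      Y-off-e : ∀ f → f ≢ e → lookup Y f ≡ 𝟘
      Y-off-e f f≢e with conforms f f≢e | conforms′ f f≢e
      ... | inj₁ z | _ = z
      ... | inj₂ w | inj₁ z′ = trans (cong (λ V → lookup V f) Y≡-Y′) (trans (lookup-negᵛ Y′ f) (cong negˢ z′))
      ... | inj₂ w | inj₂ w′ = negˢ-fixed (sym (trans (trans w (sym w′))
             (trans (sym (negˢ-involutive _)) (cong negˢ (trans (sym (lookup-negᵛ Y′ f)) (sym (cong (λ V → lookup V f) Y≡-Y′)))))))
      supp⊆e : supp Y ⊆ᵀ ⁅ e ⁆
      supp⊆e f f∈ with f Fin.≟ e
      ... | yes refl = from T-lookup (x∈⁅x⁆ e)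
      ... | no f≢e   = ⊥-elim (to isNonzero⇔ (subst T (Vec.lookup-map f isNonzero Y) f∈) (Y-off-e f f≢e))

    -- eliminating e between obstructions of both signs yields a circuit conformal to W, which is impossible
    no-two-obstructions : Obstruction R W e ⊕ → Obstruction R W e ⊖ → ⊥
    no-two-obstructions Ob₊ Ob₋ = no-conformal-circuit Z Z-circuit Z-avoids W-conforms
      where
      open Obstruction Ob₊ renaming (Y to Y₁; circuit to circ₁; avoids to avoids₁; at-e to at-e₁; conforms to conforms₁)
      open Obstruction Ob₋ renaming (Y to Y₂; circuit to circ₂; avoids to avoids₂; at-e to at-e₂; conforms to conforms₂)
      elim = C3 Y₁ Y₂ e circ₁ circ₂ (obstructions-not-opposite Ob₊ Ob₋) at-e₁ at-e₂
      Z = proj₁ elim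
      Z-circuit = proj₁ (proj₂ elim)
      Ze≡𝟘 = proj₁ (proj₂ (proj₂ elim))
      Z⁺ = proj₁ (proj₂ (proj₂ (proj₂ elim)))
      Z⁻ = proj₂ (proj₂ (proj₂ (proj₂ elim)))
      Z-off-e : ∀ {f s} → lookup Z f ≡ s → s ≢ 𝟘 → f ≢ e
      Z-off-e Zf≡s s≢𝟘 refl = s≢𝟘 (trans (sym Zf≡s) Ze≡𝟘)
      both-zero : ∀ {f s} → lookup Y₁ f ≡ 𝟘 → lookup Y₂ f ≡ 𝟘 → s ≢ 𝟘 → lookup Y₁ f ≡ s ⊎ lookup Y₂ f ≡ s → ⊥
      both-zero z₁ z₂ s≢𝟘 = [ (λ eq → s≢𝟘 (trans (sym eq) z₁)) , (λ eq → s≢𝟘 (trans (sym eq) z₂)) ]′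
      Z-avoids : Avoids R Z
      Z-avoids f r with lookup Z f in Zf
      ... | 𝟘 = refl
      ... | ⊕ = ⊥-elim (neither (λ ()) (Z⁺ f Zf))
        where neither = both-zero (avoids₁ f (∖⁺ R (Z-off-e Zf (λ ())) r)) (avoids₂ f (∖⁺ R (Z-off-e Zf (λ ())) r))
      ... | ⊖ = ⊥-elim (neither (λ ()) (Z⁻ f Zf))
        where neither = both-zero (avoids₁ f (∖⁺ R (Z-off-e Zf (λ ())) r)) (avoids₂ f (∖⁺ R (Z-off-e Zf (λ ())) r))
      W-agrees : ∀ (Yᵢ : SignVec t) → (∀ f → f ≢ e → lookup Yᵢ f ≡ 𝟘 ⊎ lookup Yᵢ f ≡ lookup W f) →
                 ∀ {f s} → f ≢ e → s ≢ 𝟘 → lookup Yᵢ f ≡ s → lookup W f ≡ s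
      W-agrees Yᵢ conformsᵢ {f} f≢e s≢𝟘 eq = [ (λ z → ⊥-elim (s≢𝟘 (trans (sym eq) z))) , (λ w → trans (sym w) eq) ]′ (conformsᵢ f f≢e)
      W-conforms : ∀ f → lookup Z f ≡ 𝟘 ⊎ (W · Z) f ≡ ⊕
      W-conforms f with lookup Z f in Zf
      ... | 𝟘 = inj₁ refl
      ... | ⊕ = inj₂ (cong (_*ˢ ⊕) ([ W-agrees Y₁ conforms₁ f≢e (λ ()) , W-agrees Y₂ conforms₂ f≢e (λ ()) ]′ (Z⁺ f Zf)))
        where f≢e = Z-off-e Zf (λ ())
      ... | ⊖ = inj₂ (cong (_*ˢ ⊖) ([ W-agrees Y₁ conforms₁ f≢e (λ ()) , W-agrees Y₂ conforms₂ f≢e (λ ()) ]′ (Z⁻ f Zf)))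
        where f≢e = Z-off-e Zf (λ ())

    meets : SignVec t → Bool
    meets Y = anyFin (λ f → (R ∖ e) f ∧ isNonzero (lookup Y f))

    unobstructed : Sign → SignVec t → Bool
    unobstructed s Y = not (isCircuit Y) ∨ (meets Y ∨ orthᵇ M (W [ e ]≔ s) Y)

    extendable : Sign → Bool
    extendable s = allList (unobstructed s) (allSignVecs t)

    extend : ∀ {s} → s ≢ 𝟘 → T (extendable s) → Extends (R ∖ e) (W [ e ]≔ s)
    extend {s} s≢𝟘 ok = record
      { conformal  = conformal′
      ; nonzero    = nonzero′
      ; X-zero     = λ f r → X-zero f (proj₁ (∖⁻ R r))
      ; orthogonal = orthogonal′ }
      where
      conformal′ : ∀ f → lookup X f ≡ 𝟘 ⊎ lookup X f ≡ lookup (W [ e ]≔ s) f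
      conformal′ f with f Fin.≟ e
      ... | yes refl = inj₁ (X-zero f e∈R)
      ... | no f≢e   = map₂ (λ eq → trans eq (sym (Vec.lookup∘update′ f≢e W s))) (conformal f)
      nonzero′ : ∀ f → ¬ T ((R ∖ e) f) → lookup (W [ e ]≔ s) f ≢ 𝟘
      nonzero′ f f∉ with f Fin.≟ e
      ... | yes refl = λ eq → s≢𝟘 (trans (sym (Vec.lookup∘update f W s)) eq)
      ... | no f≢e   = λ eq → nonzero f (λ r → f∉ (from T-∧ (r , tt))) (trans (sym (Vec.lookup∘update′ f≢e W s)) eq)
      orthogonal′ : ∀ Y → T (isCircuit Y) → Avoids (R ∖ e) Y → T (orthᵇ M (W [ e ]≔ s) Y)
      orthogonal′ Y circ avoids with to T-∨ (to (T-⇒ {isCircuit Y}) (allList⁻ {p = unobstructed s} {xs = allSignVecs t} ok (∈-allSignVecs Y)) circ)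
      ... | inj₂ orth  = orth
      ... | inj₁ meets = let (f , q) = anyFin⁻ meets ; (r , nz) = to T-∧ q in ⊥-elim (to isNonzero⇔ nz (avoids f r))

    obstructed : ∀ {s} → s ≢ 𝟘 → ¬ T (extendable s) → Obstruction R W e s
    obstructed {s} s≢𝟘 ¬ok with ¬allList⁻ {p = unobstructed s} {xs = allSignVecs t} ¬ok
    ... | Y , ¬okY with ¬T-⇒ ¬okY
    ...   | circ , ¬meets-or-orth = obstruction s≢𝟘 Y circ
      (λ f r → [ id , (λ nz → ⊥-elim (¬meets-or-orth (from T-∨ (inj₁ (anyFin⁺ f (from T-∧ (r , from isNonzero⇔ nz))))))) ]′
                 (sign-dec (lookup Y f)))
      (λ orth → ¬meets-or-orth (from (T-∨ {meets Y}) (inj₂ orth)))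

    step : ∃ (Extends (R ∖ e))
    step with T-dec (extendable ⊕) | T-dec (extendable ⊖)
    ... | inj₁ ok₊ | _       = W [ e ]≔ ⊕ , extend (λ ()) ok₊
    ... | inj₂ _   | inj₁ ok₋ = W [ e ]≔ ⊖ , extend (λ ()) ok₋
    ... | inj₂ ¬ok₊ | inj₂ ¬ok₋ = ⊥-elim (no-two-obstructions (obstructed (λ ()) ¬ok₊) (obstructed (λ ()) ¬ok₋))

  finished : ∀ {R W} → Extends R W → (∀ f → ¬ T (R f)) → Extends (λ _ → false) W
  finished ext R≡∅ = record
    { conformal  = conformal
    ; nonzero    = λ f _ → nonzero f (R≡∅ f)
    ; X-zero     = λ f ()
    ; orthogonal = λ Y circ _ → orthogonal Y circ λ f r → ⊥-elim (R≡∅ f r) }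
    where open Extends ext

  extend-fully : ∀ fuel {R W} → Extends R W → ∣ tabulate R ∣ ≤ fuel → ∃ (Extends (λ _ → false))
  extend-fully zero {R} {W} ext ∣R∣≤0 =
    W , finished ext λ f r → ℕ.<⇒≱ (∣∣-pos (tabulate R) f (subst T (sym (lookup∘tabulate R f)) r)) ∣R∣≤0
  extend-fully (suc fuel) {R} {W} ext ∣R∣≤fuel with T-dec (anyFin R)
  ... | inj₂ R≡∅ = W , finished ext λ f r → R≡∅ (anyFin⁺ f r)
  ... | inj₁ R≢∅ with anyFin⁻ R≢∅
  ...   | e , e∈R = extend-fully fuel (proj₂ (step ext e∈R)) (ℕ.≤-pred (ℕ.<-≤-trans smaller ∣R∣≤fuel))
    where
    smaller : ∣ tabulate (R ∖ e) ∣ < ∣ tabulate R ∣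
    smaller = ∣∣-strict (tabulate (R ∖ e)) (tabulate R)
      (λ f h → subst T (sym (lookup∘tabulate R f)) (proj₁ (∖⁻ R (subst T (lookup∘tabulate (R ∖ e) f) h))))
      e (subst T (sym (lookup∘tabulate R e)) e∈R)
      (λ h → proj₂ (∖⁻ R (subst T (lookup∘tabulate (R ∖ e) e) h)) refl)

-- A covector X with a zero entry extends conformally to a covector of full support, so X is not maximal.
tope-full-support : ∀ {t} (M : OrientedMatroid t) → Simple M → ∀ X → T (isTope M X) → ∀ e → lookup X e ≢ 𝟘
tope-full-support {t} M simple X tope e Xe≡𝟘 = to T-not (proj₂ (to (T-∧ {isCovector M X}) tope))
  (anyList⁺ (∈-allSignVecs W) (from T-∧ (from (covector⇔ W) (λ Y circ → orthogonal Y circ λ f ()) ,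
                                         from T-∧ (X≤W , from T-not W≰X))))
  where
  open Orthogonality M
  open Extension M simple X
  zeros : Fin t → Bool
  zeros f = lookup X f ==ˢ 𝟘
  initial : Extends zeros X
  initial = record
    { conformal  = λ _ → inj₂ refl
    ; nonzero    = λ f ¬z Xf≡𝟘 → ¬z (subst (λ s → T (s ==ˢ 𝟘)) (sym Xf≡𝟘) tt)
    ; X-zero     = λ f z → ==ˢ-sound z
    ; orthogonal = λ Y circ _ → to (covector⇔ X) (proj₁ (to T-∧ tope)) Y circ }
  full = extend-fully (suc t) initial (ℕ.m≤n⇒m≤1+n (∣p∣≤n (tabulate zeros)))
  W = proj₁ full
  open Extends (proj₂ full)
  X≤W : T (_≤ᶜ_ M X W)
  X≤W = allFin⁺ λ f → [ (λ z → from T-∨ (inj₁ (subst (λ s → T (s ==ˢ 𝟘)) (sym z) tt)))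
                      , (λ eq → from (T-∨ {lookup X f ==ˢ 𝟘}) (inj₂ (subst (λ s → T (lookup X f ==ˢ s)) eq (==ˢ-refl _)))) ]′ (conformal f)
  W≰X : ¬ T (_≤ᶜ_ M W X)
  W≰X W≤X with to (T-∨ {lookup W e ==ˢ 𝟘}) (allFin⁻ W≤X e)
  ... | inj₁ We≡𝟘 = nonzero e (λ ()) (==ˢ-sound We≡𝟘)
  ... | inj₂ We≡Xe = nonzero e (λ ()) (trans (==ˢ-sound We≡Xe) Xe≡𝟘)

module Negation {t : ℕ} (M : OrientedMatroid t) where

  open Orthogonality M

  orth-negᵛ : ∀ X Y → orthᵇ M (negᵛ X) Y ≡ orthᵇ M X Y
  orth-negᵛ X Y = cong₂ _∨_
    (cong not (anyFin-cong λ f → trans (cong isNonzero (product f)) (isNonzero-negˢ _)))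
    (trans (cong₂ _∧_ (anyFin-cong λ f → trans (cong isPos (product f)) (isPos-negˢ _))
                      (anyFin-cong λ f → trans (cong isNeg (product f)) (isNeg-negˢ _)))
           (∧-comm (anyFin (isNeg ∘ (X · Y))) (anyFin (isPos ∘ (X · Y)))))
    where
    product : ∀ f → (negᵛ X · Y) f ≡ negˢ ((X · Y) f)
    product f = trans (cong (_*ˢ lookup Y f) (lookup-negᵛ X f)) (*ˢ-negˡ _ _)

  covector-negᵛ : ∀ X → isCovector M (negᵛ X) ≡ isCovector M X
  covector-negᵛ X = allList-cong (allSignVecs t) λ Y → cong (not (isCircuit M Y) ∨_) (orth-negᵛ X Y)
    where open OrientedMatroid

  ≤ᶜ-negᵛ : ∀ X Y → _≤ᶜ_ M (negᵛ X) (negᵛ Y) ≡ _≤ᶜ_ M X Y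
  ≤ᶜ-negᵛ X Y = allFin-cong λ f →
    trans (cong₂ (λ a b → (a ==ˢ 𝟘) ∨ (a ==ˢ b)) (lookup-negᵛ X f) (lookup-negᵛ Y f)) (conformal-negˢ (lookup X f) (lookup Y f))

  above : SignVec t → SignVec t → Bool
  above X Y = isCovector M Y ∧ (_≤ᶜ_ M X Y) ∧ not (_≤ᶜ_ M Y X)

  above-negᵛ : ∀ X Y → above (negᵛ X) (negᵛ Y) ≡ above X Y
  above-negᵛ X Y = cong₂ _∧_ (covector-negᵛ Y) (cong₂ _∧_ (≤ᶜ-negᵛ X Y) (cong not (≤ᶜ-negᵛ Y X)))

  dominated-negᵛ : ∀ X → T (anyList (above (negᵛ X)) (allSignVecs t)) → T (anyList (above X) (allSignVecs t))
  dominated-negᵛ X h = anyList⁺ (∈-allSignVecs (negᵛ Y))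
    (subst T (trans (cong (above (negᵛ X)) (sym (negᵛ-involutive Y))) (above-negᵛ X (negᵛ Y))) above-Y)
    where
    Y = proj₁ (anyList⁻ {p = above (negᵛ X)} {xs = allSignVecs t} h)
    above-Y = proj₂ (anyList⁻ {p = above (negᵛ X)} {xs = allSignVecs t} h)

  tope-negᵛ : ∀ X → isTope M (negᵛ X) ≡ isTope M X
  tope-negᵛ X = cong₂ _∧_ (covector-negᵛ X) (cong not (T-ext (dominated-negᵛ X)
    (λ h → dominated-negᵛ (negᵛ X) (subst (λ Z → T (anyList (above Z) (allSignVecs t))) (sym (negᵛ-involutive X)) h))))

-- Committees of size k and |𝒯| - k correspond under S ↦ 𝒯 ∖ (-S)

majority-flip : ∀ {a} b c {d P k} → a +ⁿ k ≡ P +ⁿ P → b +ⁿ d ≡ P → c +ⁿ d ≡ k → (a < 2 *ⁿ b) ⇔ (k < 2 *ⁿ c)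
majority-flip {a} b c {d} {P} {k} a+k≡2P b+d≡P c+d≡k = mk⇔
  (λ a<2b → ℕ.+-cancelˡ-< (2 *ⁿ b) k (2 *ⁿ c) (begin-strict
    2 *ⁿ b +ⁿ k       ≡⟨ balance ⟨
    a +ⁿ 2 *ⁿ c       <⟨ ℕ.+-monoˡ-< (2 *ⁿ c) a<2b ⟩
    2 *ⁿ b +ⁿ 2 *ⁿ c  ∎))
  (λ k<2c → ℕ.+-cancelʳ-< (2 *ⁿ c) a (2 *ⁿ b) (begin-strict
    a +ⁿ 2 *ⁿ c       ≡⟨ balance ⟩
    2 *ⁿ b +ⁿ k       <⟨ ℕ.+-monoʳ-< (2 *ⁿ b) k<2c ⟩
    2 *ⁿ b +ⁿ 2 *ⁿ c  ∎))
  where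
  open ℕ.≤-Reasoning
  -- a = 2P - k, b = P - d and c = k - d
  balance : a +ⁿ 2 *ⁿ c ≡ 2 *ⁿ b +ⁿ k
  balance = ℕ.+-cancelʳ-≡ (d +ⁿ d +ⁿ k) _ _ (begin-equality
    a +ⁿ 2 *ⁿ c +ⁿ (d +ⁿ d +ⁿ k)    ≡⟨ regroupˡ a c d k ⟩
    (a +ⁿ k) +ⁿ 2 *ⁿ (c +ⁿ d)       ≡⟨ cong₂ (λ x y → x +ⁿ 2 *ⁿ y) a+k≡2P c+d≡k ⟩
    (P +ⁿ P) +ⁿ 2 *ⁿ k              ≡⟨ cong (λ x → (x +ⁿ x) +ⁿ 2 *ⁿ k) b+d≡P ⟨
    (b +ⁿ d +ⁿ (b +ⁿ d)) +ⁿ 2 *ⁿ k  ≡⟨ regroupʳ b d k ⟩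
    2 *ⁿ b +ⁿ k +ⁿ (d +ⁿ d +ⁿ k)    ∎)
    where
    regroupˡ : ∀ a c d k → a +ⁿ 2 *ⁿ c +ⁿ (d +ⁿ d +ⁿ k) ≡ (a +ⁿ k) +ⁿ 2 *ⁿ (c +ⁿ d)
    regroupˡ = ℕSolver.solve-∀
    regroupʳ : ∀ b d k → (b +ⁿ d +ⁿ (b +ⁿ d)) +ⁿ 2 *ⁿ k ≡ 2 *ⁿ b +ⁿ k +ⁿ (d +ⁿ d +ⁿ k)
    regroupʳ = ℕSolver.solve-∀

module Complement {t : ℕ} (M : OrientedMatroid t) (simple : Simple M) where

  open Negation M

  tope-isTope : ∀ i → T (isTope M (tope M i))
  tope-isTope i = proj₂ (∈-filterᵇ⁻ (isTope M) {allSignVecs t} (∈-lookup {xs = topes M} i))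

  full-support : ∀ i e → lookup (tope M i) e ≢ 𝟘
  full-support i = tope-full-support M simple (tope M i) (tope-isTope i)

  negᵛ∈topes : ∀ i → negᵛ (tope M i) ∈ topes M
  negᵛ∈topes i = ∈-filterᵇ⁺ (isTope M) (∈-allSignVecs _) (subst T (sym (tope-negᵛ (tope M i))) (tope-isTope i))

  opaque
    σ : Fin (nT M) → Fin (nT M)
    σ i = Any.index (negᵛ∈topes i)

    tope-σ : ∀ i → tope M (σ i) ≡ negᵛ (tope M i)
    tope-σ i = sym (lookup-index (negᵛ∈topes i))

  σ-involutive : ∀ i → σ (σ i) ≡ i
  σ-involutive i = lookup-injective (filterᵇ-unique (isTope M) (allSignVecs-unique t))
    (trans (tope-σ (σ i)) (trans (cong negᵛ (tope-σ i)) (negᵛ-involutive _)))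

  pos neg : Fin (nT M) → Fin t → Bool
  pos i e = isPos (lookup (tope M i) e)
  neg i e = isNeg (lookup (tope M i) e)

  pos-σ : ∀ i e → pos (σ i) e ≡ neg i e
  pos-σ i e = trans (cong (λ X → isPos (lookup X e)) (tope-σ i)) (trans (cong isPos (lookup-negᵛ (tope M i) e)) (isPos-negˢ _))

  neg-σ : ∀ i e → neg (σ i) e ≡ pos i e
  neg-σ i e = trans (cong (λ X → isNeg (lookup X e)) (tope-σ i)) (trans (cong isNeg (lookup-negᵛ (tope M i) e)) (isNeg-negˢ _))

  φ : TopeSet M → TopeSet M
  φ S = tabulate (λ i → not (lookup S (σ i)))

  φ-involutive : ∀ S → φ (φ S) ≡ S
  φ-involutive S = lookup-ext _ S λ i → trans (lookup∘tabulate _ i)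
    (trans (cong not (lookup∘tabulate _ (σ i))) (trans (not-involutive _) (cong (lookup S) (σ-involutive i))))

  #pos : Fin t → ℕ
  #pos e = ∣ tabulate (λ i → pos i e) ∣

  #neg : TopeSet M → Fin t → ℕ
  #neg S e = ∣ tabulate (λ i → lookup S i ∧ neg i e) ∣

  ∣φS∣+∣S∣≡∣𝒯∣ : ∀ S → ∣ φ S ∣ +ⁿ ∣ S ∣ ≡ nT M
  ∣φS∣+∣S∣≡∣𝒯∣ S = begin
    ∣ φ S ∣ +ⁿ ∣ S ∣                                       ≡⟨ cong₂ _+ⁿ_ (∣tabulate∣-involution σ σ-involutive (not ∘ lookup S))
                                                                           (cong ∣_∣ (sym (Vec.tabulate∘lookup S))) ⟩
    ∣ tabulate (not ∘ lookup S) ∣ +ⁿ ∣ tabulate (lookup S) ∣ ≡⟨ ∣tabulate∣-+ _ _ (λ _ → true) (λ i → complementary (lookup S i)) ⟩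
    ∣ tabulate {n = nT M} (λ _ → true) ∣                    ≡⟨ ∣tabulate∣-true (nT M) ⟩
    nT M                                                   ∎
    where
    open ≡-Reasoning
    complementary : ∀ b → ind (not b) + ind b ≡ + 1
    complementary true  = refl
    complementary false = refl

  #pos-φS+#neg-S : ∀ S e → countPos M (φ S) e +ⁿ #neg S e ≡ #pos e
  #pos-φS+#neg-S S e = begin
    countPos M (φ S) e +ⁿ #neg S e
      ≡⟨ cong (_+ⁿ #neg S e) (trans (∣tabulate∣-cong λ i → cong₂ _∧_ (lookup∘tabulate _ i) (sym (neg-σ′ i)))
                                    (∣tabulate∣-involution σ σ-involutive (λ i → not (lookup S i) ∧ neg i e))) ⟩
    ∣ tabulate (λ i → not (lookup S i) ∧ neg i e) ∣ +ⁿ #neg S e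
      ≡⟨ ∣tabulate∣-+ _ _ (λ i → neg i e) (λ i → split (lookup S i) (neg i e)) ⟩
    ∣ tabulate (λ i → neg i e) ∣
      ≡⟨ trans (∣tabulate∣-cong λ i → sym (pos-σ i e)) (∣tabulate∣-involution σ σ-involutive (λ i → pos i e)) ⟩
    #pos e ∎
    where
    open ≡-Reasoning
    neg-σ′ : ∀ i → neg (σ i) e ≡ pos i e
    neg-σ′ i = neg-σ i e
    split : ∀ b x → ind (not b ∧ x) + ind (b ∧ x) ≡ ind x
    split true  x     = ℤ.+-identityˡ (ind x)
    split false true  = refl
    split false false = refl

  #pos-S+#neg-S : ∀ S e → countPos M S e +ⁿ #neg S e ≡ ∣ S ∣
  #pos-S+#neg-S S e = trans (∣tabulate∣-+ _ _ (lookup S) λ i → split (lookup S i) (lookup (tope M i) e) (full-support i e))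
                            (cong ∣_∣ (Vec.tabulate∘lookup S))
    where
    split : ∀ b s → s ≢ 𝟘 → ind (b ∧ isPos s) + ind (b ∧ isNeg s) ≡ ind b
    split true  ⊕ _ = refl
    split true  ⊖ _ = refl
    split false ⊕ _ = refl
    split false ⊖ _ = refl
    split b     𝟘 h = ⊥-elim (h refl)

  #pos+#pos≡∣𝒯∣ : ∀ e → #pos e +ⁿ #pos e ≡ nT M
  #pos+#pos≡∣𝒯∣ e = begin
    #pos e +ⁿ #pos e                         ≡⟨ cong (#pos e +ⁿ_) (trans (sym (∣tabulate∣-involution σ σ-involutive (λ i → pos i e)))
                                                                         (∣tabulate∣-cong (λ i → pos-σ i e))) ⟩
    #pos e +ⁿ ∣ tabulate (λ i → neg i e) ∣   ≡⟨ ∣tabulate∣-+ _ _ (λ _ → true) (λ i → split (lookup (tope M i) e) (full-support i e)) ⟩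
    ∣ tabulate {n = nT M} (λ _ → true) ∣      ≡⟨ ∣tabulate∣-true (nT M) ⟩
    nT M                                     ∎
    where
    open ≡-Reasoning
    split : ∀ s → s ≢ 𝟘 → ind (isPos s) + ind (isNeg s) ≡ + 1
    split ⊕ _ = refl
    split ⊖ _ = refl
    split 𝟘 h = ⊥-elim (h refl)

  committee-φ : ∀ k → k ≤ nT M → ∀ S → isCommittee M (nT M ∸ k) (φ S) ≡ isCommittee M k S
  committee-φ k k≤∣𝒯∣ S = T-ext ⇐ ⇒
    where
    2P≡ : ∣ S ∣ ≡ k → ∀ e → ∣ φ S ∣ +ⁿ k ≡ #pos e +ⁿ #pos e
    2P≡ ∣S∣≡k e = trans (cong (∣ φ S ∣ +ⁿ_) (sym ∣S∣≡k)) (trans (∣φS∣+∣S∣≡∣𝒯∣ S) (sym (#pos+#pos≡∣𝒯∣ e)))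
    flip : ∀ e → ∣ S ∣ ≡ k → (∣ φ S ∣ < 2 *ⁿ countPos M (φ S) e) ⇔ (k < 2 *ⁿ countPos M S e)
    flip e ∣S∣≡k = majority-flip (countPos M (φ S) e) (countPos M S e) (2P≡ ∣S∣≡k e) (#pos-φS+#neg-S S e) (trans (#pos-S+#neg-S S e) ∣S∣≡k)
    ∣φS∣≡ : ∣ S ∣ ≡ k → ∣ φ S ∣ ≡ nT M ∸ k
    ∣φS∣≡ ∣S∣≡k = trans (sym (ℕ.m+n∸n≡m ∣ φ S ∣ ∣ S ∣)) (cong₂ _∸_ (∣φS∣+∣S∣≡∣𝒯∣ S) ∣S∣≡k)
    ⇐ : T (isCommittee M (nT M ∸ k) (φ S)) → T (isCommittee M k S)
    ⇐ h = from T-∧ (ℕ.≡⇒≡ᵇ ∣ S ∣ k ∣S∣≡k , allFin⁺ λ e → ℕ.<⇒<ᵇ (to (flip e ∣S∣≡k) (subst (_< 2 *ⁿ countPos M (φ S) e) (sym ∣φS∣≡n∸k)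
              (ℕ.<ᵇ⇒< (nT M ∸ k) _ (allFin⁻ maj e)))))
      where
      ∣φS∣≡n∸k = ℕ.≡ᵇ⇒≡ ∣ φ S ∣ (nT M ∸ k) (proj₁ (to (T-∧ {∣ φ S ∣ ≡ᵇ nT M ∸ k}) h))
      maj = proj₂ (to (T-∧ {∣ φ S ∣ ≡ᵇ nT M ∸ k}) h)
      ∣S∣≡k : ∣ S ∣ ≡ k
      ∣S∣≡k = trans (sym (ℕ.m+n∸m≡n ∣ φ S ∣ ∣ S ∣)) (trans (cong₂ _∸_ (∣φS∣+∣S∣≡∣𝒯∣ S) ∣φS∣≡n∸k) (ℕ.m∸[m∸n]≡n k≤∣𝒯∣))
    ⇒ : T (isCommittee M k S) → T (isCommittee M (nT M ∸ k) (φ S))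
    ⇒ h = from T-∧ (ℕ.≡⇒≡ᵇ ∣ φ S ∣ (nT M ∸ k) (∣φS∣≡ ∣S∣≡k) , allFin⁺ λ e → ℕ.<⇒<ᵇ (subst (_< 2 *ⁿ countPos M (φ S) e) (∣φS∣≡ ∣S∣≡k)
            (from (flip e ∣S∣≡k) (ℕ.<ᵇ⇒< k _ (allFin⁻ maj e)))))
      where
      maj = proj₂ (to (T-∧ {∣ S ∣ ≡ᵇ k}) h)
      ∣S∣≡k = ℕ.≡ᵇ⇒≡ ∣ S ∣ k (proj₁ (to (T-∧ {∣ S ∣ ≡ᵇ k}) h))

  numCommittees-complement : ∀ k → k ≤ nT M → numCommittees M k ≡ numCommittees M (nT M ∸ k)
  numCommittees-complement k k≤∣𝒯∣ = ℤ.+-injective (begin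
    + numCommittees M k                                          ≡⟨ length-filterᵇ (isCommittee M k) (allSubsets (nT M)) ⟩
    ∑[ S ∈ allSubsets (nT M) ] ind (isCommittee M k S)           ≡⟨ ∑-cong (allSubsets (nT M)) (λ S → cong ind (committee-φ k k≤∣𝒯∣ S)) ⟨
    ∑[ S ∈ allSubsets (nT M) ] ind (isCommittee M (nT M ∸ k) (φ S)) ≡⟨ ∑-allSubsets-involution φ φ-involutive (ind ∘ isCommittee M (nT M ∸ k)) ⟩
    ∑[ S ∈ allSubsets (nT M) ] ind (isCommittee M (nT M ∸ k) S)  ≡⟨ length-filterᵇ (isCommittee M (nT M ∸ k)) (allSubsets (nT M)) ⟨
    + numCommittees M (nT M ∸ k)                                 ∎)
    where open ≡-Reasoning

-- Committees and the candidate sets d ∈ ⋃ₑ binom(𝒯⁺ₑ, ⌈(k+1)/2⌉)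

k<2*⌈[k+1]/2⌉ : ∀ k → k < 2 *ⁿ ⌈ suc k /2⌉
k<2*⌈[k+1]/2⌉ k = begin
  suc k                          ≡⟨ ℕ.⌊n/2⌋+⌈n/2⌉≡n (suc k) ⟨
  ⌊ suc k /2⌋ +ⁿ ⌈ suc k /2⌉     ≤⟨ ℕ.+-monoˡ-≤ ⌈ suc k /2⌉ (ℕ.⌊n/2⌋≤⌈n/2⌉ (suc k)) ⟩
  ⌈ suc k /2⌉ +ⁿ ⌈ suc k /2⌉     ≡⟨ cong (⌈ suc k /2⌉ +ⁿ_) (ℕ.+-identityʳ _) ⟨
  2 *ⁿ ⌈ suc k /2⌉               ∎
  where open ℕ.≤-Reasoning

k<2*c⇒⌈[k+1]/2⌉≤c : ∀ k c → k < 2 *ⁿ c → ⌈ suc k /2⌉ ≤ c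
k<2*c⇒⌈[k+1]/2⌉≤c k c k<2c = ℕ.≤-trans (ℕ.⌈n/2⌉-mono (ℕ.≤-trans k<2c (ℕ.≤-reflexive (cong (c +ⁿ_) (ℕ.+-identityʳ c)))))
  (ℕ.≤-reflexive (sym (ℕ.n≡⌈n+n/2⌉ c)))

module Committees {t : ℕ} (M : OrientedMatroid t) (k : ℕ) where

  Cand : Set
  Cand = Fin (N M k)

  d : Cand → TopeSet M
  d = cand M k

  isCand : TopeSet M → Bool
  isCand S = (∣ S ∣ ≡ᵇ m M k) ∧ anyFin (inPosHalf M k S)

  d-isCand : ∀ j → T (isCand (d j))
  d-isCand j = proj₂ (∈-filterᵇ⁻ isCand {allSubsets (nT M)} (∈-lookup {xs = candidates M k} j))

  ∣d∣≡m : ∀ j → ∣ d j ∣ ≡ m M k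
  ∣d∣≡m j = ℕ.≡ᵇ⇒≡ _ _ (proj₁ (to T-∧ (d-isCand j)))

  d-injective : ∀ {i j} → d i ≡ d j → i ≡ j
  d-injective = lookup-injective (filterᵇ-unique isCand (allSubsets-unique (nT M)))

  d-surjective : ∀ G e → ∣ G ∣ ≡ m M k → T (inPosHalf M k G e) → ∃ λ j → d j ≡ G
  d-surjective G e ∣G∣≡m G⊆𝒯⁺ = Any.index G∈ , sym (lookup-index G∈)
    where
    G∈ : G ∈ candidates M k
    G∈ = ∈-filterᵇ⁺ isCand {allSubsets (nT M)} (∈-allSubsets G) (from T-∧ (ℕ.≡⇒≡ᵇ _ _ ∣G∣≡m , anyFin⁺ e G⊆𝒯⁺))

  γd : Cand → Subset t
  γd j = γ M k (d j)

  hits : Cand → Fin t → Bool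
  hits j = lookup (γd j)

  hits-inPosHalf : ∀ j e → hits j e ≡ inPosHalf M k (d j) e
  hits-inPosHalf j e = lookup∘tabulate (inPosHalf M k (d j)) e

  γ-nonempty : ∀ j → ∃ (T ∘ hits j)
  γ-nonempty j with anyFin⁻ (proj₂ (to (T-∧ {∣ d j ∣ ≡ᵇ m M k}) (d-isCand j)))
  ... | e , pos = e , subst T (sym (hits-inPosHalf j e)) pos

  inPosHalf⇔ : ∀ G e → T (inPosHalf M k G e) ⇔ (∀ i → T (lookup G i) → T (isPos (lookup (tope M i) e)))
  inPosHalf⇔ G e = mk⇔ (λ h i → to (T-⇒ {lookup G i}) (allFin⁻ h i))
                       (λ h → allFin⁺ λ i → from (T-⇒ {lookup G i}) (h i))

  posPart : TopeSet M → Fin t → TopeSet M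
  posPart S e = tabulate (λ i → lookup S i ∧ isPos (lookup (tope M i) e))

  posPart⇔ : ∀ S e i → T (lookup (posPart S e) i) ⇔ (T (lookup S i) × T (isPos (lookup (tope M i) e)))
  posPart⇔ S e i = subst (λ b → T b ⇔ (T (lookup S i) × T (isPos (lookup (tope M i) e))))
    (sym (lookup∘tabulate (λ i → lookup S i ∧ isPos (lookup (tope M i) e)) i)) T-∧

  inside : TopeSet M → Cand → Bool
  inside S j = d j ⊆ᵇ S

  Covered : TopeSet M → Set
  Covered S = ∀ e → ∃ λ j → T (inside S j) × T (hits j e)

  majority : TopeSet M → Bool
  majority S = allFin (λ e → k <ᵇ 2 *ⁿ countPos M S e)

  covered⇒majority : ∀ S → Covered S → T (majority S)
  covered⇒majority S cov = allFin⁺ λ e → let (j , d⊆S , hit) = cov e in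
    ℕ.<⇒<ᵇ (ℕ.<-≤-trans (k<2*⌈[k+1]/2⌉ k) (ℕ.*-monoʳ-≤ 2
      (subst (_≤ countPos M S e) (∣d∣≡m j) (∣∣-mono (d j) (posPart S e) λ i i∈d →
        from (posPart⇔ S e i) (⊆ᵇ⁻ (d j) S d⊆S i i∈d , to (inPosHalf⇔ (d j) e) (subst T (hits-inPosHalf j e) hit) i i∈d)))))

  -- Opaque: nothing computes with these witnesses, and unfolding them makes type checking very slow.
  opaque
    majority⇒covered : ∀ S → T (majority S) → Covered S
    majority⇒covered S maj e = j , ⊆ᵇ⁺ (d j) S dj⊆S , subst T (sym (hits-inPosHalf j e)) dj⊆𝒯⁺
      where
      m≤∣S⁺∣ : m M k ≤ countPos M S e
      m≤∣S⁺∣ = k<2*c⇒⌈[k+1]/2⌉≤c k (countPos M S e) (ℕ.<ᵇ⇒< k _ (allFin⁻ maj e))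
      G : TopeSet M
      G = proj₁ (subset-of-size (m M k) (posPart S e) m≤∣S⁺∣)
      G⊆S⁺ : G ⊆ᵀ posPart S e
      G⊆S⁺ = proj₁ (proj₂ (subset-of-size (m M k) (posPart S e) m≤∣S⁺∣))
      ∣G∣≡m : ∣ G ∣ ≡ m M k
      ∣G∣≡m = proj₂ (proj₂ (subset-of-size (m M k) (posPart S e) m≤∣S⁺∣))
      in-S⁺ : ∀ i → T (lookup G i) → T (lookup S i) × T (isPos (lookup (tope M i) e))
      in-S⁺ i i∈G = to (posPart⇔ S e i) (G⊆S⁺ i i∈G)
      G⊆𝒯⁺ : T (inPosHalf M k G e)
      G⊆𝒯⁺ = from (inPosHalf⇔ G e) λ i i∈G → proj₂ (in-S⁺ i i∈G)
      j : Cand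
      j = proj₁ (d-surjective G e ∣G∣≡m G⊆𝒯⁺)
      dj≡G : d j ≡ G
      dj≡G = proj₂ (d-surjective G e ∣G∣≡m G⊆𝒯⁺)
      dj⊆S : d j ⊆ᵀ S
      dj⊆S i i∈ = proj₁ (in-S⁺ i (subst (λ X → T (lookup X i)) dj≡G i∈))
      dj⊆𝒯⁺ : T (inPosHalf M k (d j) e)
      dj⊆𝒯⁺ = subst (λ X → T (inPosHalf M k X e)) (sym dj≡G) G⊆𝒯⁺

  ⋃-⊆ : ∀ S (𝒢 : Family M k) → (∀ j → T (lookup 𝒢 j) → T (inside S j)) → ⋃𝒢 M k 𝒢 ⊆ᵀ S
  ⋃-⊆ S 𝒢 h i i∈⋃ with anyFin⁻ (subst T (lookup∘tabulate (λ i → anyFin (λ j → lookup 𝒢 j ∧ lookup (d j) i)) i) i∈⋃)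
  ... | j , q = ⊆ᵇ⁻ (d j) S (h j (proj₁ (to T-∧ q))) i (proj₂ (to (T-∧ {lookup 𝒢 j}) q))

  ⊆-⋃ : ∀ (𝒢 : Family M k) j → T (lookup 𝒢 j) → d j ⊆ᵀ ⋃𝒢 M k 𝒢
  ⊆-⋃ 𝒢 j j∈𝒢 i i∈d = subst T (sym (lookup∘tabulate (λ i → anyFin (λ j → lookup 𝒢 j ∧ lookup (d j) i)) i))
                                (anyFin⁺ j (from T-∧ (j∈𝒢 , i∈d)))

  Hypothesis : Set
  Hypothesis = ∀ (𝒢 : Family M k) → T (admissible M k 𝒢) → ∀ j → T (lookup 𝒢 j) → ∣ γd j ∣ ≡ 1

  -- The candidates inside S with inclusion-maximal γ form an admissible family when S is covered.
  module Maximal (S : TopeSet M) where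

    dominated : Cand → Bool
    dominated j = anyFin (λ j′ → inside S j′ ∧ (γd j ⊂ᵇ γd j′))

    𝒢max : Family M k
    𝒢max = tabulate (λ j → inside S j ∧ not (dominated j))

    𝒢max⇔ : ∀ j → T (lookup 𝒢max j) ⇔ (T (inside S j) × ¬ T (dominated j))
    𝒢max⇔ j = subst (λ b → T b ⇔ (T (inside S j) × ¬ T (dominated j)))
      (sym (lookup∘tabulate (λ j → inside S j ∧ not (dominated j)) j))
      (mk⇔ (λ h → let (a , b) = to T-∧ h in a , to T-not b) (λ (a , b) → from T-∧ (a , from T-not b)))

    opaque
      below-max : ∀ j → T (inside S j) → ∃ λ j* → T (lookup 𝒢max j*) × γd j ⊆ᵀ γd j*
      below-max j j⊆S = climb (suc t) j j⊆S (s≤s (ℕ.m∸n≤m t ∣ γd j ∣))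
        where
        -- the gap t ∸ ∣ γd j ∣ decreases strictly along strict inclusions
        climb : ∀ fuel j → T (inside S j) → t ∸ ∣ γd j ∣ < fuel → ∃ λ j* → T (lookup 𝒢max j*) × γd j ⊆ᵀ γd j*
        climb (suc fuel) j j⊆S gap = [ higher , maximal ]′ (T-dec (dominated j))
          where
          maximal : ¬ T (dominated j) → ∃ λ j* → T (lookup 𝒢max j*) × γd j ⊆ᵀ γd j*
          maximal ¬dom = j , from (𝒢max⇔ j) (j⊆S , ¬dom) , λ _ h → h
          higher : T (dominated j) → ∃ λ j* → T (lookup 𝒢max j*) × γd j ⊆ᵀ γd j*
          higher dom =
            let (j′ , q) = anyFin⁻ dom
                (j′⊆S , γj⊂γj′) = to (T-∧ {inside S j′}) q
                (γj⊆γj′ , γj′⊈γj) = to (T-∧ {γd j ⊆ᵇ γd j′}) γj⊂γj′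
                γj⊆ᵀγj′ = ⊆ᵇ⁻ (γd j) (γd j′) γj⊆γj′
                (e , e∈γj′ , e∉γj) = ¬⊆ᵇ⁻ (γd j′) (γd j) (to T-not γj′⊈γj)
                smaller = ℕ.∸-monoʳ-< (∣∣-strict (γd j) (γd j′) γj⊆ᵀγj′ e e∈γj′ e∉γj) (∣p∣≤n (γd j′))
                (j* , j*∈ , γj′⊆γj*) = climb fuel j′ j′⊆S (ℕ.<-≤-trans smaller (ℕ.≤-pred gap))
            in j* , j*∈ , λ e h → γj′⊆γj* e (γj⊆ᵀγj′ e h)

    max-minimal : ∀ j → T (lookup 𝒢max j) → T (isMinγ M k 𝒢max j)
    max-minimal j j∈ = from T-not λ h → let (j′ , q) = anyFin⁻ h ; (j′∈ , γj′⊂γj) = to T-∧ q in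
      proj₂ (to (𝒢max⇔ j′) j′∈) (anyFin⁺ j (from T-∧ (proj₁ (to (𝒢max⇔ j) j∈) , γj′⊂γj)))

    max-admissible : ∣ S ∣ ≡ k → Covered S → T (admissible M k 𝒢max)
    max-admissible ∣S∣≡k cov = from T-∧ (allFin⁺ covers-e , ℕ.≤⇒≤ᵇ (subst (∣ ⋃𝒢 M k 𝒢max ∣ ≤_) ∣S∣≡k
      (∣∣-mono (⋃𝒢 M k 𝒢max) S (⋃-⊆ S 𝒢max λ j j∈ → proj₁ (to (𝒢max⇔ j) j∈)))))
      where
      covers-e : ∀ e → T (anyFin (λ j → lookup 𝒢max j ∧ isMinγ M k 𝒢max j ∧ hits j e))
      covers-e e = let (j , j⊆S , hit) = cov e ; (j* , j*∈ , γj⊆γj*) = below-max j j⊆S in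
        anyFin⁺ j* (from T-∧ (j*∈ , from T-∧ (max-minimal j* j*∈ , γj⊆γj* e hit)))

  opaque
    singletons : Hypothesis → ∀ S → ∣ S ∣ ≡ k → Covered S → ∀ j → T (inside S j) → Singleton (hits j)
    singletons H S ∣S∣≡k cov j j⊆S = e , e∈ , λ y y∈ → ∣∣≡1⇒unique (γd j) ∣γj∣≡1 y∈ e∈
      where
      open Maximal S
      e : Fin t
      e = proj₁ (γ-nonempty j)
      e∈ : T (hits j e)
      e∈ = proj₂ (γ-nonempty j)
      j* : Cand
      j* = proj₁ (below-max j j⊆S)
      ∣γj∣≡1 : ∣ γd j ∣ ≡ 1
      ∣γj∣≡1 = ℕ.≤-antisym
        (subst (∣ γd j ∣ ≤_) (H 𝒢max (max-admissible ∣S∣≡k cov) j* (proj₁ (proj₂ (below-max j j⊆S))))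
               (∣∣-mono (γd j) (γd j*) (proj₂ (proj₂ (below-max j j⊆S)))))
        (∣∣-pos (γd j) e e∈)

    inRange⇒covering : ∀ 𝒢 → T (inRange M k 𝒢) → ∀ e → ∃ λ j → T (lookup 𝒢 j) × T (hits j e)
    inRange⇒covering 𝒢 r e = j , proj₁ (to (T-∧ {lookup 𝒢 j}) q)
                               , proj₂ (to (T-∧ {isMinγ M k 𝒢 j}) (proj₂ (to (T-∧ {lookup 𝒢 j}) q)))
      where
      member : Cand → Bool
      member j = lookup 𝒢 j ∧ isMinγ M k 𝒢 j ∧ hits j e
      𝒢-covers : T (coversᵇ M k 𝒢)
      𝒢-covers = proj₁ (to (T-∧ {coversᵇ M k 𝒢}) (proj₁ (to (T-∧ {admissible M k 𝒢}) r)))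
      witness : ∃ (T ∘ member)
      witness = anyFin⁻ {p = member} (allFin⁻ 𝒢-covers e)
      j : Cand
      j = proj₁ witness
      q : T (member j)
      q = proj₂ witness

  ⋃⊆⇒inside : ∀ S (𝒢 : Family M k) → T (⋃𝒢 M k 𝒢 ⊆ᵇ S) → ∀ j → T (lookup 𝒢 j) → T (inside S j)
  ⋃⊆⇒inside S 𝒢 ⋃⊆S j j∈ = ⊆ᵇ⁺ (d j) S λ i i∈d → ⊆ᵇ⁻ (⋃𝒢 M k 𝒢) S ⋃⊆S i (⊆-⋃ 𝒢 j j∈ i i∈d)

  ∣𝒢∣-count : ∀ (𝒢 : Family M k) → count (lookup 𝒢) (List.allFin (N M k)) ≡ ∣ 𝒢 ∣
  ∣𝒢∣-count 𝒢 = ℤ.+-injective (trans (length-filterᵇ (lookup 𝒢) (List.allFin (N M k))) (sym (∣∣-∑ 𝒢)))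

  module Covering (S : TopeSet M) (∣S∣≡k : ∣ S ∣ ≡ k) (single : ∀ j → T (inside S j) → Singleton (hits j))
                  (𝒢 : Family M k) (in-S : ∀ j → T (lookup 𝒢 j) → T (inside S j))
                  (cov : ∀ e → ∃ λ j → T (lookup 𝒢 j) × T (hits j e)) where

    hit-by : ∀ {j e e′} → T (lookup 𝒢 j) → T (hits j e) → T (hits j e′) → e ≡ e′
    hit-by {j} j∈ h h′ = let (_ , _ , only) = single j (in-S j j∈) in trans (only _ h) (sym (only _ h′))

    minimal : ∀ j → T (lookup 𝒢 j) → T (isMinγ M k 𝒢 j)
    minimal j j∈ = from T-not λ h →
      let (j′ , q) = anyFin⁻ h ; (j′∈ , γj′⊂γj) = to T-∧ q
          (γj′⊆γj , γj⊈γj′) = to (T-∧ {γd j′ ⊆ᵇ γd j}) γj′⊂γj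
          (x , x∈ , _) = single j′ (in-S j′ j′∈)
      in to T-not γj⊈γj′ (⊆ᵇ⁺ (γd j) (γd j′) λ y y∈ →
           subst (T ∘ hits j′) (hit-by j∈ (⊆ᵇ⁻ (γd j′) (γd j) γj′⊆γj x x∈) y∈) x∈)

    ∣⋃∣≤k : ∣ ⋃𝒢 M k 𝒢 ∣ ≤ k
    ∣⋃∣≤k = subst (∣ ⋃𝒢 M k 𝒢 ∣ ≤_) ∣S∣≡k (∣∣-mono (⋃𝒢 M k 𝒢) S (⋃-⊆ S 𝒢 in-S))

    -- e ↦ a member of 𝒢 hitting e is injective
    t≤∣𝒢∣ : t ≤ ∣ 𝒢 ∣
    t≤∣𝒢∣ = subst₂ _≤_ (∣⊤∣≡n t) (∣𝒢∣-count 𝒢)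
      (injection⇒∣∣≤count Fin._≟_ (Unique.allFin⁺ (N M k)) ∈-allFin ⊤ (proj₁ ∘ cov)
        (λ {e} {e′} _ _ same → hit-by (proj₁ (proj₂ (cov e))) (proj₂ (proj₂ (cov e)))
                                  (subst (λ j → T (hits j e′)) (sym same) (proj₂ (proj₂ (cov e′)))))
        (λ e _ → proj₁ (proj₂ (cov e))))

    -- j ↦ d j maps 𝒢 injectively into the ⌈(k+1)/2⌉-subsets of S
    ∣𝒢∣≤kCm : ∣ 𝒢 ∣ ≤ k C m M k
    ∣𝒢∣≤kCm = subst (∣ 𝒢 ∣ ≤_) #⌈k+1/2⌉-subsets
      (injection⇒∣∣≤count (Vec.≡-dec Bool._≟_) (allSubsets-unique (nT M)) ∈-allSubsets 𝒢 d
        (λ _ _ → d-injective) (λ j j∈ → from T-∧ (ℕ.≡⇒≡ᵇ _ _ (∣d∣≡m j) , in-S j j∈)))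
      where
      #⌈k+1/2⌉-subsets : count (λ G → (∣ G ∣ ≡ᵇ m M k) ∧ (G ⊆ᵇ S)) (allSubsets (nT M)) ≡ k C m M k
      #⌈k+1/2⌉-subsets = ℤ.+-injective (trans (length-filterᵇ _ (allSubsets (nT M)))
                           (trans (#subsets≡C S (m M k)) (cong (λ s → + (s C m M k)) ∣S∣≡k)))

    inRange-𝒢 : T (inRange M k 𝒢)
    inRange-𝒢 = from T-∧ (from T-∧ (allFin⁺ covers-e , ℕ.≤⇒≤ᵇ ∣⋃∣≤k) , from T-∧ (ℕ.≤⇒≤ᵇ t≤∣𝒢∣ , ℕ.≤⇒≤ᵇ ∣𝒢∣≤kCm))
      where
      covers-e : ∀ e → T (anyFin (λ j → lookup 𝒢 j ∧ isMinγ M k 𝒢 j ∧ hits j e))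
      covers-e e = let (j , j∈ , hit) = cov e in anyFin⁺ j (from T-∧ (j∈ , from T-∧ (minimal j j∈ , hit)))

  contributes : TopeSet M → Family M k → Bool
  contributes S 𝒢 = inRange M k 𝒢 ∧ ((∣ S ∣ ≡ᵇ k) ∧ (⋃𝒢 M k 𝒢 ⊆ᵇ S))

  contributes⇒covering : ∀ S 𝒢 → T (contributes S 𝒢) → ∀ e → ∃ λ j → T (inside S j) × T (hits j e)
  contributes⇒covering S 𝒢 h e = j , ⋃⊆⇒inside S 𝒢 ⋃⊆S j (proj₁ (proj₂ cov)) , proj₂ (proj₂ cov)
    where
    inRange′ = proj₁ (to (T-∧ {inRange M k 𝒢}) h)
    ⋃⊆S = proj₂ (to (T-∧ {∣ S ∣ ≡ᵇ k}) (proj₂ (to (T-∧ {inRange M k 𝒢}) h)))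
    cov = inRange⇒covering 𝒢 inRange′ e
    j = proj₁ cov

  ∑-contributions-vanish : ∀ S → (∀ 𝒢 → ¬ T (contributes S 𝒢)) → ¬ T (isCommittee M k S) →
    ∑[ 𝒢 ∈ allSubsets (N M k) ] (ind (contributes S 𝒢) * sign 𝒢) ≡ (- (+ 1)) ^ t * ind (isCommittee M k S)
  ∑-contributions-vanish S ¬contributes ¬comm =
    trans (∑-zero (allSubsets (N M k)) λ {𝒢} _ → trans (cong (_* sign 𝒢) (ind-false (¬contributes 𝒢))) (ℤ.*-zeroˡ (sign 𝒢)))
          (sym (trans (cong ((- (+ 1)) ^ t *_) (ind-false ¬comm)) (ℤ.*-zeroʳ ((- (+ 1)) ^ t))))

  ∑-contributions-committee : Hypothesis → ∀ S → T (∣ S ∣ ≡ᵇ k) → T (majority S) →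
    ∑[ 𝒢 ∈ allSubsets (N M k) ] (ind (contributes S 𝒢) * sign 𝒢) ≡ (- (+ 1)) ^ t * ind (isCommittee M k S)
  ∑-contributions-committee H S ∣S∣≡k maj = begin
    ∑[ 𝒢 ∈ allSubsets (N M k) ] (ind (contributes S 𝒢) * sign 𝒢)
      ≡⟨ ∑-cong (allSubsets (N M k)) (λ 𝒢 → cong (λ b → ind b * sign 𝒢) (contributes≡covering 𝒢)) ⟩
    ∑[ 𝒢 ∈ allSubsets (N M k) ] (ind (within (inside S) 𝒢 ∧ covers hits (λ _ → false) 𝒢) * sign 𝒢)
      ≡⟨ ∑-sign-covers (inside S) hits single (λ _ → false) ⟩
    ∏ (λ e → + 0 - ind (reached (inside S) hits e))
      ≡⟨ ∏-cong (λ e → cong (λ b → + 0 - ind b) (reached-all e)) ⟩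
    ∏ {t} (λ _ → - (+ 1))
      ≡⟨ ∏-const t (- (+ 1)) ⟩
    (- (+ 1)) ^ t
      ≡⟨ ℤ.*-identityʳ ((- (+ 1)) ^ t) ⟨
    (- (+ 1)) ^ t * + 1
      ≡⟨ cong (λ b → (- (+ 1)) ^ t * ind b) (to T-≡ (from (T-∧ {∣ S ∣ ≡ᵇ k}) (∣S∣≡k , maj))) ⟨
    (- (+ 1)) ^ t * ind (isCommittee M k S) ∎
    where
    open ≡-Reasoning
    ∣S∣≡kⁿ = ℕ.≡ᵇ⇒≡ ∣ S ∣ k ∣S∣≡k
    cov = majority⇒covered S maj
    single = singletons H S ∣S∣≡kⁿ cov
    reached-all : ∀ e → reached (inside S) hits e ≡ true
    reached-all e = to T-≡ (anyFin⁺ {p = λ j → inside S j ∧ hits j e} (proj₁ (cov e)) (from T-∧ (proj₂ (cov e))))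
    contributes≡covering : ∀ 𝒢 → contributes S 𝒢 ≡ (within (inside S) 𝒢 ∧ covers hits (λ _ → false) 𝒢)
    contributes≡covering 𝒢 = T-ext ⇒covering ⇐covering
      where
      ⇒covering : T (contributes S 𝒢) → T (within (inside S) 𝒢 ∧ covers hits (λ _ → false) 𝒢)
      ⇒covering h = from (T-∧ {within (inside S) 𝒢})
        ( from (within⇔ (inside S) 𝒢) (⋃⊆⇒inside S 𝒢 (proj₂ (to (T-∧ {∣ S ∣ ≡ᵇ k}) (proj₂ (to (T-∧ {inRange M k 𝒢}) h)))))
        , from (covers-none⇔ hits 𝒢) (inRange⇒covering 𝒢 (proj₁ (to (T-∧ {inRange M k 𝒢}) h))))
      ⇐covering : T (within (inside S) 𝒢 ∧ covers hits (λ _ → false) 𝒢) → T (contributes S 𝒢)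
      ⇐covering h = from (T-∧ {inRange M k 𝒢}) (inRange-𝒢 , from (T-∧ {∣ S ∣ ≡ᵇ k}) (∣S∣≡k , ⊆ᵇ⁺ (⋃𝒢 M k 𝒢) S (⋃-⊆ S 𝒢 in-S)))
        where
        in-S = to (within⇔ (inside S) 𝒢) (proj₁ (to (T-∧ {within (inside S) 𝒢}) h))
        open Covering S ∣S∣≡kⁿ single 𝒢 in-S (to (covers-none⇔ hits 𝒢) (proj₂ (to (T-∧ {within (inside S) 𝒢}) h)))

  ∑-contributions : Hypothesis → ∀ S →
    ∑[ 𝒢 ∈ allSubsets (N M k) ] (ind (contributes S 𝒢) * sign 𝒢) ≡ (- (+ 1)) ^ t * ind (isCommittee M k S)
  ∑-contributions H S = [ (λ ∣S∣≡k → [ ∑-contributions-committee H S ∣S∣≡k , not-majority ]′ (T-dec (majority S))) , wrong-size ]′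
                (T-dec (∣ S ∣ ≡ᵇ k))
    where
    wrong-size : ¬ T (∣ S ∣ ≡ᵇ k) → _
    wrong-size ∣S∣≢k = ∑-contributions-vanish S
      (λ 𝒢 h → ∣S∣≢k (proj₁ (to (T-∧ {∣ S ∣ ≡ᵇ k}) (proj₂ (to (T-∧ {inRange M k 𝒢}) h)))))
      (λ h → ∣S∣≢k (proj₁ (to (T-∧ {∣ S ∣ ≡ᵇ k}) h)))
    not-majority : ¬ T (majority S) → _
    not-majority ¬maj = ∑-contributions-vanish S
      (λ 𝒢 h → ¬maj (covered⇒majority S (contributes⇒covering S 𝒢 h)))
      (λ h → ¬maj (proj₂ (to (T-∧ {∣ S ∣ ≡ᵇ k}) h)))

  -- the binomial coefficient in the term of 𝒢 counts the k-supersets S of ⋃𝒢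
  term≡∑-contributions : ∀ 𝒢 → ind (inRange M k 𝒢) * term M k 𝒢 ≡ ∑[ S ∈ allSubsets (nT M) ] (ind (contributes S 𝒢) * sign 𝒢)
  term≡∑-contributions 𝒢 = [ in-range , out-of-range ]′ (T-dec (inRange M k 𝒢))
    where
    ⋃ = ⋃𝒢 M k 𝒢
    out-of-range : ¬ T (inRange M k 𝒢) → _
    out-of-range ¬r = trans (trans (cong (_* term M k 𝒢) (ind-false ¬r)) (ℤ.*-zeroˡ (term M k 𝒢)))
      (sym (∑-zero (allSubsets (nT M)) λ {S} _ →
        trans (cong (_* sign 𝒢) (ind-false λ h → ¬r (proj₁ (to (T-∧ {inRange M k 𝒢}) h)))) (ℤ.*-zeroˡ (sign 𝒢))))
    in-range : T (inRange M k 𝒢) → _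
    in-range r = begin
      ind (inRange M k 𝒢) * (sign 𝒢 * + ((nT M ∸ ∣ ⋃ ∣) C (k ∸ ∣ ⋃ ∣)))
        ≡⟨ cong (λ b → ind b * term M k 𝒢) (to T-≡ r) ⟩
      + 1 * (sign 𝒢 * + ((nT M ∸ ∣ ⋃ ∣) C (k ∸ ∣ ⋃ ∣)))
        ≡⟨ ℤ.*-identityˡ _ ⟩
      sign 𝒢 * + ((nT M ∸ ∣ ⋃ ∣) C (k ∸ ∣ ⋃ ∣))
        ≡⟨ cong (sign 𝒢 *_) (#supersets≡C ⋃ ∣⋃∣≤k) ⟨
      sign 𝒢 * #supersets ⋃ k
        ≡⟨ ∑-*ˡ (allSubsets (nT M)) (sign 𝒢) _ ⟨
      ∑[ S ∈ allSubsets (nT M) ] (sign 𝒢 * ind ((∣ S ∣ ≡ᵇ k) ∧ (⋃ ⊆ᵇ S)))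
        ≡⟨ ∑-cong (allSubsets (nT M)) (λ S → trans (ℤ.*-comm (sign 𝒢) _)
             (cong (λ b → ind (b ∧ ((∣ S ∣ ≡ᵇ k) ∧ (⋃ ⊆ᵇ S))) * sign 𝒢) (sym (to T-≡ r)))) ⟩
      ∑[ S ∈ allSubsets (nT M) ] (ind (contributes S 𝒢) * sign 𝒢) ∎
      where
      open ≡-Reasoning
      ∣⋃∣≤k : ∣ ⋃ ∣ ≤ k
      ∣⋃∣≤k = ℕ.≤ᵇ⇒≤ ∣ ⋃ ∣ k (proj₂ (to (T-∧ {coversᵇ M k 𝒢}) (proj₁ (to (T-∧ {admissible M k 𝒢}) r))))

  formula : Hypothesis → + numCommittees M k ≡ rhs M k
  formula H = sym (begin
    rhs M k
      ≡⟨ cong (±1 *_) (trans (sumℤ-map (term M k) (filterᵇ (inRange M k) (allSubsets (N M k)))) (∑-filterᵇ (inRange M k) (allSubsets (N M k)) (term M k))) ⟩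
    ±1 * (∑[ 𝒢 ∈ allSubsets (N M k) ] (ind (inRange M k 𝒢) * term M k 𝒢))
      ≡⟨ cong (±1 *_) (∑-cong (allSubsets (N M k)) term≡∑-contributions) ⟩
    ±1 * (∑[ 𝒢 ∈ allSubsets (N M k) ] ∑[ S ∈ allSubsets (nT M) ] (ind (contributes S 𝒢) * sign 𝒢))
      ≡⟨ cong (±1 *_) (∑-comm (allSubsets (N M k)) (allSubsets (nT M)) _) ⟩
    ±1 * (∑[ S ∈ allSubsets (nT M) ] ∑[ 𝒢 ∈ allSubsets (N M k) ] (ind (contributes S 𝒢) * sign 𝒢))
      ≡⟨ cong (±1 *_) (∑-cong (allSubsets (nT M)) (∑-contributions H)) ⟩
    ±1 * (∑[ S ∈ allSubsets (nT M) ] (±1 * ind (isCommittee M k S)))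
      ≡⟨ cong (±1 *_) (∑-*ˡ (allSubsets (nT M)) ±1 _) ⟩
    ±1 * (±1 * (∑[ S ∈ allSubsets (nT M) ] ind (isCommittee M k S)))
      ≡⟨ [-1]^t*[-1]^t*x≡x t _ ⟩
    ∑[ S ∈ allSubsets (nT M) ] ind (isCommittee M k S)
      ≡⟨ length-filterᵇ (isCommittee M k) (allSubsets (nT M)) ⟨
    + numCommittees M k ∎)
    where
    open ≡-Reasoning
    ±1 = (- (+ 1)) ^ t
    sumℤ-map : ∀ (f : A → ℤ) xs → sumℤ M k (map f xs) ≡ ∑ xs f
    sumℤ-map f []       = refl
    sumℤ-map f (x ∷ xs) = cong (_+_ (f x)) (sumℤ-map f xs)
    [-1]^t*[-1]^t*x≡x : ∀ t x → (- (+ 1)) ^ t * ((- (+ 1)) ^ t * x) ≡ x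
    [-1]^t*[-1]^t*x≡x zero    x = trans (ℤ.*-identityˡ _) (ℤ.*-identityˡ x)
    [-1]^t*[-1]^t*x≡x (suc t) x =
      trans (square (- (+ 1)) ((- (+ 1)) ^ t) x) (trans (ℤ.*-identityˡ _) ([-1]^t*[-1]^t*x≡x t x))
      where
      square : ∀ a b x → a * b * (a * b * x) ≡ a * a * (b * (b * x))
      square = solve-∀

corollary4p2 : (t : ℕ) (M : OrientedMatroid t) → Simple M → NotAcyclic M →
    (k : ℕ) → 3 ≤ k → k ≤ nT M ∸ 3 →
    (∀ (𝒢 : Family M k) → T (admissible M k 𝒢) →
       ∀ j → T (lookup 𝒢 j) → ∣ γ M k (cand M k j) ∣ ≡ 1) →
    (numCommittees M k ≡ numCommittees M (nT M ∸ k))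
      × (+ (numCommittees M k) ≡ rhs M k)
corollary4p2 t M simple _ k _ k≤∣𝒯∣∸3 H =
  Complement.numCommittees-complement M simple k (ℕ.≤-trans k≤∣𝒯∣∸3 (ℕ.m∸n≤m (nT M) 3)) ,
  Committees.formula M k H
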